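{- For $n\ge1$, the expected number of lucky cars in a uniformly random unit Fubini ranking with $n$ competitors is \[\mathbb{E}[\mathrm{lucky}(\alpha):\alpha\in\mathrm{UFR}_n]=\frac{\bigl((3n+1)\sqrt3+6n\bigr)(1+\sqrt3)^n-\bigl((3n+1)\sqrt3-6n\bigr)(1-\sqrt3)^n}{3(3+\sqrt3)(1+\sqrt3)^n+3(3-\sqrt3)(1-\sqrt3)^n}.\] Moreover, $\mathbb{E}[\mathrm{lucky}(\alpha):\alpha\in\mathrm{UFR}_n]\sim\dfrac{3(2+\sqrt3)n+\sqrt3}{3(3+\sqrt3)}$ as $n\to\infty$.
   Context: $\mathrm{UFR}_n$ is the set of unit Fubini rankings with $n$ competitors: tuples $\alpha=(a_1,\ldots,a_n)\in\{1,\ldots,n\}^n$ with $a_i=1+|\{j:a_j<a_i\}|$ for every $i$ and in which each value appears at most twice. $\mathrm{lucky}(\alpha)$ is the number of lucky cars: cars $1,\ldots,n$ enter in order a one-way street with spots $1,\ldots,n$, car $i$ parks at spot $a_i$ if free, else at the first free spot after $a_i$, and is lucky if it parks at $a_i$. $f\sim g$ means $f(n)/g(n)\to1$. -}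

module Defs where

open import Data.Bool using (Bool; true; false; _∧_; if_then_else_; not)
open import Data.Nat as ℕ using (ℕ; zero; suc; _<ᵇ_; _≡ᵇ_; _≤ᵇ_)
open import Data.List using (List; []; _∷_; length; map; concatMap; filterᵇ; upTo; foldr)
open import Data.Bool.ListAction using (all)
open import Data.Nat.ListAction using (sum)
open import Data.Product using (_×_; _,_)
open import Data.Sum using (_⊎_)
open import Data.Integer using (+_)
open import Data.Rational as ℚ using (ℚ; 0ℚ; 1ℚ; _÷_; _/_; ≢-nonZero)
open import Data.Rational.Properties using (_≟_)
open import Relation.Nullary using (yes; no)

tuples : ℕ → ℕ → List (List ℕ)
tuples zero    n = [] ∷ []
tuples (suc k) n = concatMap (λ a → map (a ∷_) (tuples k n)) (map suc (upTo n))

countᵇ : (ℕ → Bool) → List ℕ → ℕ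
countᵇ p xs = length (filterᵇ p xs)

isFubiniᵇ : List ℕ → Bool
isFubiniᵇ α = all (λ a → a ≡ᵇ suc (countᵇ (λ b → b <ᵇ a) α)) α

isUnitᵇ : List ℕ → Bool
isUnitᵇ α = all (λ a → countᵇ (λ b → b ≡ᵇ a) α ≤ᵇ 2) α

-- UFR_n, as a list (without repetitions) of tuples in {1..n}^n
UFR : ℕ → List (List ℕ)
UFR n = filterᵇ (λ α → isFubiniᵇ α ∧ isUnitᵇ α) (tuples n n)

occupied : ℕ → List ℕ → Bool
occupied s os = foldr (λ o r → (o ≡ᵇ s) Data.Bool.∨ r) false os

-- first free spot among s, s+1, …, n (fuel = number of spots still to try)
firstFree : ℕ → ℕ → List ℕ → (Bool × ℕ)
firstFree zero       s os = false , s
firstFree (suc fuel) s os =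
  if occupied s os then firstFree fuel (suc s) os else (true , s)

-- park the cars with preferences α on a street with spots 1..n,
-- given already occupied spots; returns the number of lucky cars.
-- A car that finds no free spot at or after its preference leaves.
parkLucky : ℕ → List ℕ → List ℕ → ℕ
parkLucky n os []      = 0
parkLucky n os (a ∷ α) with occupied a os
... | false = suc (parkLucky n (a ∷ os) α)
... | true  with firstFree (suc n) a os
...   | true  , s = parkLucky n (s ∷ os) α
...   | false , _ = parkLucky n os α

lucky : ℕ → List ℕ → ℕ
lucky n α = parkLucky n [] α

ℕ→ℚ : ℕ → ℚ
ℕ→ℚ n = + n / 1

-- total division on ℚ (x / 0 := 0; only used with nonzero divisors)
_div_ : ℚ → ℚ → ℚ
p div q with q ≟ 0ℚ
... | yes _ = 0ℚ
... | no q≢0 = _÷_ p q {{≢-nonZero q≢0}}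

expectedLucky : ℕ → ℚ
expectedLucky n = ℕ→ℚ (sum (map (lucky n) (UFR n))) div ℕ→ℚ (length (UFR n))

record ℚ√3 : Set where
  constructor _+_√3
  field
    re im : ℚ
open ℚ√3 public

infixl 6 _⊕_ _⊖_
infixl 7 _⊗_ _⊘_

fromℚ : ℚ → ℚ√3
fromℚ q = q + 0ℚ √3

fromℕ : ℕ → ℚ√3
fromℕ n = fromℚ (ℕ→ℚ n)

√3 : ℚ√3
√3 = 0ℚ + 1ℚ √3

_⊕_ : ℚ√3 → ℚ√3 → ℚ√3
(a + b √3) ⊕ (c + d √3) = (a ℚ.+ c) + (b ℚ.+ d) √3

neg : ℚ√3 → ℚ√3
neg (a + b √3) = (ℚ.- a) + (ℚ.- b) √3

_⊖_ : ℚ√3 → ℚ√3 → ℚ√3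
x ⊖ y = x ⊕ neg y

_⊗_ : ℚ√3 → ℚ√3 → ℚ√3
(a + b √3) ⊗ (c + d √3) =
  (a ℚ.* c ℚ.+ ℕ→ℚ 3 ℚ.* (b ℚ.* d)) + (a ℚ.* d ℚ.+ b ℚ.* c) √3

_^_ : ℚ√3 → ℕ → ℚ√3
x ^ zero  = fromℚ 1ℚ
x ^ suc k = x ⊗ (x ^ k)

-- multiplicative inverse: (a + b√3)⁻¹ = (a − b√3)/(a² − 3b²); 0⁻¹ := 0
-- (a² − 3b² ≠ 0 whenever a + b√3 ≠ 0, since √3 is irrational)
inv : ℚ√3 → ℚ√3
inv (a + b √3) = (a div N) + ((ℚ.- b) div N) √3
  where N = a ℚ.* a ℚ.- ℕ→ℚ 3 ℚ.* (b ℚ.* b)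

_⊘_ : ℚ√3 → ℚ√3 → ℚ√3
x ⊘ y = x ⊗ inv y

-- the order of ℝ restricted to ℚ(√3): a + b√3 > 0
Positive : ℚ√3 → Set
Positive (a + b √3) =
    (0ℚ ℚ.≤ a × 0ℚ ℚ.≤ b × (0ℚ ℚ.< a ⊎ 0ℚ ℚ.< b))
  ⊎ (0ℚ ℚ.< a × b ℚ.< 0ℚ × ℕ→ℚ 3 ℚ.* (b ℚ.* b) ℚ.< a ℚ.* a)
  ⊎ (a ℚ.< 0ℚ × 0ℚ ℚ.< b × a ℚ.* a ℚ.< ℕ→ℚ 3 ℚ.* (b ℚ.* b))

_<√_ : ℚ√3 → ℚ√3 → Set
x <√ y = Positive (y ⊖ x)

AbsLt : ℚ√3 → ℚ → Set
AbsLt x ε = (neg (fromℚ ε) <√ x) × (x <√ fromℚ ε)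

one : ℚ√3
one = fromℚ 1ℚ

numer : ℕ → ℚ√3
numer n =
    ((fromℕ (3 ℕ.* n ℕ.+ 1) ⊗ √3 ⊕ fromℕ (6 ℕ.* n)) ⊗ ((one ⊕ √3) ^ n))
  ⊖ ((fromℕ (3 ℕ.* n ℕ.+ 1) ⊗ √3 ⊖ fromℕ (6 ℕ.* n)) ⊗ ((one ⊖ √3) ^ n))

denom : ℕ → ℚ√3
denom n =
    (fromℕ 3 ⊗ (fromℕ 3 ⊕ √3) ⊗ ((one ⊕ √3) ^ n))
  ⊕ (fromℕ 3 ⊗ (fromℕ 3 ⊖ √3) ⊗ ((one ⊖ √3) ^ n))

asymp : ℕ → ℚ√3
asymp n = (fromℕ 3 ⊗ (fromℕ 2 ⊕ √3) ⊗ fromℕ n ⊕ √3) ⊘ (fromℕ 3 ⊗ (fromℕ 3 ⊕ √3))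

_∼_ : (ℕ → ℚ√3) → (ℕ → ℚ√3) → Set
f ∼ g = (ε : ℚ) → 0ℚ ℚ.< ε →
  Data.Product.∃ λ N → (n : ℕ) → N ℕ.≤ n → AbsLt ((f n ⊘ g n) ⊖ one) ε

-- In a unit Fubini ranking the cars of rank 1 form a block of one or two, and removing them leaves a
-- ranking of the other cars whose ranks start one or two higher. For u n = |UFR n| and for the sum
-- d n over UFR n of the number of distinct ranks this gives
--   u (n+2) = (n+2) u (n+1) + C(n+2,2) u n,
--   d (n+2) = (n+2) (u (n+1) + d (n+1)) + C(n+2,2) (u n + d n).
-- A car is lucky exactly when it is the first with its preference, because the spot after a rank
-- taken twice is never a preference; so the lucky cars sum to d n. With (1 + √3)ⁿ = p + q√3 the
-- recurrences solve to 2ⁿ u n = n! (p + q) and 3 · 2ⁿ d n = n! (2np + (3n+1)q), which is the closed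
-- formula. For the asymptotics, E/asymp − 1 = (α − β√3)/δ with naturals α, β, δ for which
-- |α² − 3β²| = (n+1)² (3n² − 6n − 1) 2ⁿ is tiny compared with αδ; since α − β√3 = (α² − 3β²)/(α + β√3),
-- the quotient tends to 0.

module Submission where

open import Defs
open import Data.Nat using (ℕ; _≤_)
open import Data.Product using (_×_; _,_)
open import Relation.Binary.PropositionalEquality using (_≡_)
open import Algebra.Bundles using (CommutativeMonoid)
import Algebra.Properties.CommutativeSemigroup as CommutativeSemigroupProperties
import Data.Bool.Properties
import Data.Nat.Properties

module +-CS = CommutativeSemigroupProperties Data.Nat.Properties.+-commutativeSemigroup
module ∧-CS = CommutativeSemigroupProperties (CommutativeMonoid.commutativeSemigroup Data.Bool.Properties.∧-commutativeMonoid)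
module ∨-CS = CommutativeSemigroupProperties (CommutativeMonoid.commutativeSemigroup Data.Bool.Properties.∨-commutativeMonoid)

module Sums where

  open import Data.Bool using (Bool; true; false; _∧_)
  open import Data.Nat using (ℕ; zero; suc; _+_; _*_; _<_; _≡ᵇ_; s≤s)
  open import Data.Nat.Properties
  open import Data.List using (List; []; _∷_; map; concatMap; upTo; _++_)
  open import Data.List.Properties using (map-upTo)
  open import Data.List.Relation.Unary.All using (All; []; _∷_)
  open import Relation.Binary.PropositionalEquality
  open import Function using (_∘_)

  infix 2 sumOver
  sumOver : {A : Set} → List A → (A → ℕ) → ℕ
  sumOver []       f = 0
  sumOver (x ∷ xs) f = f x + sumOver xs f
  syntax sumOver xs (λ x → e) = ∑[ x ∈ xs ] e

  module _ {A : Set} where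

    ∑-cong : (xs : List A) {f g : A → ℕ} → (∀ x → f x ≡ g x) → sumOver xs f ≡ sumOver xs g
    ∑-cong []       f≗g = refl
    ∑-cong (x ∷ xs) f≗g = cong₂ _+_ (f≗g x) (∑-cong xs f≗g)

    ∑-++ : (xs ys : List A) (f : A → ℕ) → sumOver (xs ++ ys) f ≡ sumOver xs f + sumOver ys f
    ∑-++ []       ys f = refl
    ∑-++ (x ∷ xs) ys f = trans (cong (f x +_) (∑-++ xs ys f)) (sym (+-assoc (f x) _ _))

    ∑-zero : (xs : List A) → (∑[ x ∈ xs ] 0) ≡ 0
    ∑-zero []       = refl
    ∑-zero (x ∷ xs) = ∑-zero xs

    ∑-+ : (xs : List A) (f g : A → ℕ) → (∑[ x ∈ xs ] (f x + g x)) ≡ sumOver xs f + sumOver xs g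
    ∑-+ []       f g = refl
    ∑-+ (x ∷ xs) f g = trans (cong (f x + g x +_) (∑-+ xs f g)) (+-CS.interchange (f x) (g x) _ _)

    ∑-*ˡ : (c : ℕ) (xs : List A) (f : A → ℕ) → (∑[ x ∈ xs ] c * f x) ≡ c * sumOver xs f
    ∑-*ˡ c []       f = sym (*-zeroʳ c)
    ∑-*ˡ c (x ∷ xs) f = trans (cong (c * f x +_) (∑-*ˡ c xs f)) (sym (*-distribˡ-+ c (f x) _))

    ∑-*ʳ : (c : ℕ) (xs : List A) (f : A → ℕ) → (∑[ x ∈ xs ] f x * c) ≡ sumOver xs f * c
    ∑-*ʳ c []       f = refl
    ∑-*ʳ c (x ∷ xs) f = trans (cong (f x * c +_) (∑-*ʳ c xs f)) (sym (*-distribʳ-+ c (f x) _))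

    ∑-congᴬ : (xs : List A) {f g : A → ℕ} → All (λ x → f x ≡ g x) xs → sumOver xs f ≡ sumOver xs g
    ∑-congᴬ []       []         = refl
    ∑-congᴬ (x ∷ xs) (fx≡gx ∷ e) = cong₂ _+_ fx≡gx (∑-congᴬ xs e)

  module _ {A B : Set} where

    ∑-map : (h : A → B) (xs : List A) (f : B → ℕ) → sumOver (map h xs) f ≡ sumOver xs (f ∘ h)
    ∑-map h []       f = refl
    ∑-map h (x ∷ xs) f = cong (f (h x) +_) (∑-map h xs f)

    ∑-concatMap : (g : A → List B) (xs : List A) (f : B → ℕ) →
                  sumOver (concatMap g xs) f ≡ (∑[ x ∈ xs ] sumOver (g x) f)
    ∑-concatMap g []       f = refl
    ∑-concatMap g (x ∷ xs) f = trans (∑-++ (g x) _ f) (cong (sumOver (g x) f +_) (∑-concatMap g xs f))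

    ∑-swap : (xs : List A) (ys : List B) (f : A → B → ℕ) →
             (∑[ x ∈ xs ] ∑[ y ∈ ys ] f x y) ≡ (∑[ y ∈ ys ] ∑[ x ∈ xs ] f x y)
    ∑-swap []       ys f = sym (∑-zero ys)
    ∑-swap (x ∷ xs) ys f =
      trans (cong (sumOver ys (f x) +_) (∑-swap xs ys f)) (sym (∑-+ ys (f x) _))

  ⟦_⟧ : Bool → ℕ
  ⟦ true  ⟧ = 1
  ⟦ false ⟧ = 0

  ∑-upTo-suc : (n : ℕ) (f : ℕ → ℕ) → sumOver (upTo (suc n)) f ≡ f 0 + (∑[ a ∈ upTo n ] f (suc a))
  ∑-upTo-suc n f = cong (f 0 +_) (trans (cong (λ l → sumOver l f) (sym (map-upTo suc n))) (∑-map suc (upTo n) f))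

  ∑-upTo-single : (c : ℕ → Bool) {N a : ℕ} → a < N → (∑[ w ∈ upTo N ] ⟦ (a ≡ᵇ w) ∧ c w ⟧) ≡ ⟦ c a ⟧
  ∑-upTo-single c {suc N} {zero}  _          =
    trans (∑-upTo-suc N (λ w → ⟦ (0 ≡ᵇ w) ∧ c w ⟧)) (trans (cong (⟦ c 0 ⟧ +_) (∑-zero (upTo N))) (+-identityʳ ⟦ c 0 ⟧))
  ∑-upTo-single c {suc N} {suc a} (s≤s a<N) = trans (∑-upTo-suc N (λ w → ⟦ (suc a ≡ᵇ w) ∧ c w ⟧)) (∑-upTo-single (λ w → c (suc w)) a<N)

module Masks where

  open Sums
  open import Data.Bool using (Bool; true; false)
  open import Data.Nat using (ℕ; zero; suc; _+_; _*_; _∸_; _≡ᵇ_)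
  open import Data.Nat.Combinatorics using (_C_; nCk+nC[k+1]≡[n+1]C[k+1])
  open import Data.List.Relation.Unary.All as All using (All; []; _∷_)
  open import Data.List.Relation.Unary.All.Properties using (++⁺; map⁺)
  open import Data.Nat.Properties
  open import Data.List using (List; []; _∷_; map; upTo; _++_)
  open import Relation.Binary.PropositionalEquality

  masks : ℕ → List (List Bool)
  masks zero    = [] ∷ []
  masks (suc k) = map (true ∷_) (masks k) ++ map (false ∷_) (masks k)

  ones zeros : List Bool → ℕ
  ones []          = 0
  ones (true  ∷ s) = suc (ones s)
  ones (false ∷ s) = ones s
  zeros []          = 0
  zeros (true  ∷ s) = zeros s
  zeros (false ∷ s) = suc (zeros s)

  -- Every tuple over {1,…,n+1} is withOnes s β for the mask s of its entries 1 and β over {1,…,n}.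
  withOnes : List Bool → List ℕ → List ℕ
  withOnes []          β       = map suc β
  withOnes (true  ∷ s) β       = 1 ∷ withOnes s β
  withOnes (false ∷ s) []      = withOnes s []
  withOnes (false ∷ s) (b ∷ β) = suc b ∷ withOnes s β

  ∑-masks-suc : (k : ℕ) (F : List Bool → ℕ) →
    sumOver (masks (suc k)) F ≡ (∑[ s ∈ masks k ] F (true ∷ s)) + (∑[ s ∈ masks k ] F (false ∷ s))
  ∑-masks-suc k F = trans (∑-++ (map (true ∷_) (masks k)) _ F) (cong₂ _+_ (∑-map _ (masks k) F) (∑-map _ (masks k) F))

  ∑-tuples-suc : (k n : ℕ) (f : List ℕ → ℕ) →
    sumOver (tuples (suc k) n) f ≡ (∑[ a ∈ upTo n ] ∑[ α ∈ tuples k n ] f (suc a ∷ α))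
  ∑-tuples-suc k n f = trans (∑-concatMap _ (map suc (upTo n)) f)
    (trans (∑-map suc (upTo n) _) (∑-cong (upTo n) (λ a → ∑-map (suc a ∷_) (tuples k n) f)))

  ∑-tuples-byOnes : (k n : ℕ) (f : List ℕ → ℕ) →
    sumOver (tuples k (suc n)) f ≡ (∑[ s ∈ masks k ] ∑[ β ∈ tuples (zeros s) n ] f (withOnes s β))
  ∑-tuples-byOnes zero    n f = sym (+-identityʳ _)
  ∑-tuples-byOnes (suc k) n f = begin
      sumOver (tuples (suc k) (suc n)) f
    ≡⟨ trans (∑-tuples-suc k (suc n) f) (∑-upTo-suc n _) ⟩
      sumOver (tuples k (suc n)) (λ α → f (1 ∷ α))
        + (∑[ a ∈ upTo n ] sumOver (tuples k (suc n)) (λ α → f (suc (suc a) ∷ α)))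
    ≡⟨ cong₂ _+_ (∑-tuples-byOnes k n _) (∑-cong (upTo n) (λ a → ∑-tuples-byOnes k n _)) ⟩
      (∑[ s ∈ masks k ] ∑[ β ∈ tuples (zeros s) n ] f (withOnes (true ∷ s) β))
        + (∑[ a ∈ upTo n ] ∑[ s ∈ masks k ] ∑[ β ∈ tuples (zeros s) n ] f (suc (suc a) ∷ withOnes s β))
    ≡⟨ cong ((∑[ s ∈ masks k ] ∑[ β ∈ tuples (zeros s) n ] f (withOnes (true ∷ s) β)) +_) (trans (∑-swap (upTo n) (masks k) _)
                          (∑-cong (masks k) (λ s → sym (∑-tuples-suc (zeros s) n _)))) ⟩
      (∑[ s ∈ masks k ] ∑[ β ∈ tuples (zeros s) n ] f (withOnes (true ∷ s) β))
        + (∑[ s ∈ masks k ] ∑[ β ∈ tuples (zeros (false ∷ s)) n ] f (withOnes (false ∷ s) β))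
    ≡⟨ sym (∑-masks-suc k _) ⟩
      (∑[ s ∈ masks (suc k) ] ∑[ β ∈ tuples (zeros s) n ] f (withOnes s β))
    ∎
    where open ≡-Reasoning

  masks-ones+zeros : (k : ℕ) → All (λ s → ones s + zeros s ≡ k) (masks k)
  masks-ones+zeros zero    = refl ∷ []
  masks-ones+zeros (suc k) = ++⁺ (map⁺ (All.map (cong suc) (masks-ones+zeros k)))
                                 (map⁺ (All.map (λ {s} e → trans (+-suc (ones s) _) (cong suc e)) (masks-ones+zeros k)))

  ∑-masks-ones≡ : (k t : ℕ) → (∑[ s ∈ masks k ] ⟦ ones s ≡ᵇ t ⟧) ≡ k C t
  ∑-masks-ones≡ zero    zero    = refl
  ∑-masks-ones≡ zero    (suc t) = refl
  ∑-masks-ones≡ (suc k) zero    = trans (∑-masks-suc k _) (cong₂ _+_ (∑-zero (masks k)) (∑-masks-ones≡ k zero))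
  ∑-masks-ones≡ (suc k) (suc t) = trans (∑-masks-suc k _)
    (trans (cong₂ _+_ (∑-masks-ones≡ k t) (∑-masks-ones≡ k (suc t))) (nCk+nC[k+1]≡[n+1]C[k+1] k t))

  ∑-masks-byOnes≤2 : (k : ℕ) (F : ℕ → ℕ → ℕ) → (∀ t m → F (3 + t) m ≡ 0) →
    (∑[ s ∈ masks k ] F (ones s) (zeros s)) ≡ F 0 k + (k C 1) * F 1 (k ∸ 1) + (k C 2) * F 2 (k ∸ 2)
  ∑-masks-byOnes≤2 k F F≥3≡0 = begin
      (∑[ s ∈ masks k ] F (ones s) (zeros s))
    ≡⟨ ∑-congᴬ (masks k) (All.map (λ {s} e → byOnes (ones s) (zeros s) e) (masks-ones+zeros k)) ⟩
      (∑[ s ∈ masks k ] (⟦ ones s ≡ᵇ 0 ⟧ * F 0 k + ⟦ ones s ≡ᵇ 1 ⟧ * F 1 (k ∸ 1)) + ⟦ ones s ≡ᵇ 2 ⟧ * F 2 (k ∸ 2))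
    ≡⟨ trans (∑-+ (masks k) _ _) (cong (_+ (∑[ s ∈ masks k ] ⟦ ones s ≡ᵇ 2 ⟧ * F 2 (k ∸ 2))) (∑-+ (masks k) _ _)) ⟩
      (∑[ s ∈ masks k ] ⟦ ones s ≡ᵇ 0 ⟧ * F 0 k) + (∑[ s ∈ masks k ] ⟦ ones s ≡ᵇ 1 ⟧ * F 1 (k ∸ 1))
        + (∑[ s ∈ masks k ] ⟦ ones s ≡ᵇ 2 ⟧ * F 2 (k ∸ 2))
    ≡⟨ cong₂ _+_ (cong₂ _+_ (trans (count 0) (+-identityʳ (F 0 k))) (count 1)) (count 2) ⟩
      F 0 k + (k C 1) * F 1 (k ∸ 1) + (k C 2) * F 2 (k ∸ 2)
    ∎
    where
    open ≡-Reasoning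
    count : ∀ t → (∑[ s ∈ masks k ] ⟦ ones s ≡ᵇ t ⟧ * F t (k ∸ t)) ≡ (k C t) * F t (k ∸ t)
    count t = trans (∑-*ʳ (F t (k ∸ t)) (masks k) _) (cong (_* F t (k ∸ t)) (∑-masks-ones≡ k t))
    byOnes : ∀ t m → t + m ≡ k →
      F t m ≡ (⟦ t ≡ᵇ 0 ⟧ * F 0 k + ⟦ t ≡ᵇ 1 ⟧ * F 1 (k ∸ 1)) + ⟦ t ≡ᵇ 2 ⟧ * F 2 (k ∸ 2)
    byOnes 0 m refl = sym (trans (+-identityʳ _) (trans (+-identityʳ _) (+-identityʳ _)))
    byOnes 1 m refl = sym (trans (+-identityʳ _) (+-identityʳ _))
    byOnes 2 m refl = sym (+-identityʳ _)
    byOnes (suc (suc (suc t))) m refl = F≥3≡0 t m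

module WithOnes where

  open Sums
  open Masks
  open import Data.Bool using (Bool; true; false; _∧_; _∨_; not)
  open import Data.Bool.Properties using (∨-zeroʳ)
  open import Data.Bool.ListAction using (all; and)
  open import Data.Nat using (ℕ; zero; suc; _+_; _*_; _≤_; _≡ᵇ_; z≤n; s≤s)
  open import Data.Nat.Properties
  open import Data.List using (List; []; _∷_; map)
  open import Data.List.Properties using (map-∘)
  open import Data.List.Relation.Unary.All as All using (All; []; _∷_)
  open import Data.List.Relation.Unary.All.Properties using (map⁺; concat⁺; all-upTo)
  open import Data.Product using (_×_; _,_)
  open import Relation.Binary.PropositionalEquality
  open import Function using (_∘_)

  tuples-entries : (k n : ℕ) → All (All (λ a → 1 ≤ a × a ≤ n)) (tuples k n)
  tuples-entries zero    n = [] ∷ []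
  tuples-entries (suc k) n = concat⁺ (map⁺ (All.map (λ a-ok → map⁺ (All.map (a-ok ∷_) (tuples-entries k n)))
                                                      (map⁺ (All.map (λ i<n → s≤s z≤n , i<n) (all-upTo n)))))

  countᵇ-∷ : (p : ℕ → Bool) (x : ℕ) (xs : List ℕ) → countᵇ p (x ∷ xs) ≡ ⟦ p x ⟧ + countᵇ p xs
  countᵇ-∷ p x xs with p x
  ... | true  = refl
  ... | false = refl

  count-withOnes : (p : ℕ → Bool) (s : List Bool) (β : List ℕ) →
    countᵇ p (withOnes s β) ≡ ones s * ⟦ p 1 ⟧ + countᵇ (p ∘ suc) β
  count-withOnes p []          β       = count-map β
    where
    count-map : ∀ β → countᵇ p (map suc β) ≡ countᵇ (p ∘ suc) β
    count-map []      = refl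
    count-map (b ∷ β) = trans (countᵇ-∷ p (suc b) _)
      (trans (cong (⟦ p (suc b) ⟧ +_) (count-map β)) (sym (countᵇ-∷ (p ∘ suc) b β)))
  count-withOnes p (true  ∷ s) β       = trans (countᵇ-∷ p 1 _)
    (trans (cong (⟦ p 1 ⟧ +_) (count-withOnes p s β)) (sym (+-assoc ⟦ p 1 ⟧ _ _)))
  count-withOnes p (false ∷ s) []      = count-withOnes p s []
  count-withOnes p (false ∷ s) (b ∷ β) = begin
      countᵇ p (suc b ∷ withOnes s β)
    ≡⟨ countᵇ-∷ p (suc b) _ ⟩
      ⟦ p (suc b) ⟧ + countᵇ p (withOnes s β)
    ≡⟨ cong (⟦ p (suc b) ⟧ +_) (count-withOnes p s β) ⟩
      ⟦ p (suc b) ⟧ + (ones s * ⟦ p 1 ⟧ + countᵇ (p ∘ suc) β)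
    ≡⟨ +-CS.x∙yz≈y∙xz ⟦ p (suc b) ⟧ (ones s * ⟦ p 1 ⟧) _ ⟩
      ones s * ⟦ p 1 ⟧ + (⟦ p (suc b) ⟧ + countᵇ (p ∘ suc) β)
    ≡⟨ cong (ones s * ⟦ p 1 ⟧ +_) (sym (countᵇ-∷ (p ∘ suc) b β)) ⟩
      ones s * ⟦ p 1 ⟧ + countᵇ (p ∘ suc) (b ∷ β)
    ∎
    where open ≡-Reasoning

  all-withOnes : (p : ℕ → Bool) (s : List Bool) (β : List ℕ) →
    all p (withOnes s β) ≡ ((ones s ≡ᵇ 0) ∨ p 1) ∧ all (p ∘ suc) β
  all-withOnes p []          β       = cong and (sym (map-∘ β))
  all-withOnes p (true  ∷ s) β       = trans (cong (p 1 ∧_) (all-withOnes p s β)) (absorb (p 1))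
    where
    absorb : ∀ x → x ∧ (((ones s ≡ᵇ 0) ∨ x) ∧ all (p ∘ suc) β) ≡ x ∧ all (p ∘ suc) β
    absorb true  = cong (_∧ all (p ∘ suc) β) (∨-zeroʳ (ones s ≡ᵇ 0))
    absorb false = refl
  all-withOnes p (false ∷ s) []      = all-withOnes p s []
  all-withOnes p (false ∷ s) (b ∷ β) = trans (cong (p (suc b) ∧_) (all-withOnes p s β)) (∧-CS.x∙yz≈y∙xz (p (suc b)) ((ones s ≡ᵇ 0) ∨ p 1) (all (p ∘ suc) β))

  occupied-withOnes-1 : (s : List Bool) (β : List ℕ) → All (1 ≤_) β →
    occupied 1 (withOnes s β) ≡ not (ones s ≡ᵇ 0)
  occupied-withOnes-1 []          []            []           = refl
  occupied-withOnes-1 []          (suc b ∷ β)   (_ ∷ β≥1)    = occupied-withOnes-1 [] β β≥1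
  occupied-withOnes-1 (true  ∷ s) β             β≥1          = refl
  occupied-withOnes-1 (false ∷ s) []            []           = occupied-withOnes-1 s [] []
  occupied-withOnes-1 (false ∷ s) (suc b ∷ β)   (_ ∷ β≥1)    = occupied-withOnes-1 s β β≥1

  occupied-withOnes-suc : (w : ℕ) (s : List Bool) (β : List ℕ) →
    occupied (suc (suc w)) (withOnes s β) ≡ occupied (suc w) β
  occupied-withOnes-suc w []          []      = refl
  occupied-withOnes-suc w []          (b ∷ β) = cong ((b ≡ᵇ suc w) ∨_) (occupied-withOnes-suc w [] β)
  occupied-withOnes-suc w (true  ∷ s) β       = occupied-withOnes-suc w s β
  occupied-withOnes-suc w (false ∷ s) []      = occupied-withOnes-suc w s []
  occupied-withOnes-suc w (false ∷ s) (b ∷ β) = cong ((b ≡ᵇ suc w) ∨_) (occupied-withOnes-suc w s β)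

module ShiftedRankings where

  open Sums
  open Masks
  open WithOnes
  open import Data.Bool using (Bool; true; false; _∧_; _∨_; not)
  import Data.Bool.Properties as Bool
  open import Data.Bool.ListAction using (all)
  open import Data.Nat using (ℕ; zero; suc; _+_; _*_; _≤_; _<ᵇ_; _≡ᵇ_; _≤ᵇ_; s≤s)
  open import Data.Nat.Properties
  open import Data.List using (List; []; _∷_; upTo)
  open import Data.List.Relation.Unary.All as All using (All; []; _∷_)
  open import Data.List.Relation.Unary.Any using (here; there)
  open import Data.List.Membership.Propositional using (_∈_)
  open import Data.List.Extrema ≤-totalOrder using (min; argmin-sel; min≤⊤; min≤xs; v≤min⁺)
  open import Data.Sum using (inj₁; inj₂)
  open import Relation.Binary.PropositionalEquality

  isFubiniFromᵇ : ℕ → List ℕ → Bool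
  isFubiniFromᵇ j α = all (λ a → a ≡ᵇ j + countᵇ (λ b → b <ᵇ a) α) α

  isUFRFromᵇ : ℕ → List ℕ → Bool
  isUFRFromᵇ j α = isFubiniFromᵇ j α ∧ isUnitᵇ α

  distinctValues : ℕ → List ℕ → ℕ
  distinctValues N α = ∑[ w ∈ upTo N ] ⟦ occupied (suc w) α ⟧

  all-congᴬ : (p q : ℕ → Bool) (xs : List ℕ) → All (λ x → p x ≡ q x) xs → all p xs ≡ all q xs
  all-congᴬ p q []       []           = refl
  all-congᴬ p q (x ∷ xs) (px≡qx ∷ e) = cong₂ _∧_ px≡qx (all-congᴬ p q xs e)

  all-false : (p : ℕ → Bool) {x : ℕ} {xs : List ℕ} → x ∈ xs → p x ≡ false → all p xs ≡ false
  all-false p {xs = y ∷ ys} (here refl) px≡false = cong (_∧ all p ys) px≡false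
  all-false p {xs = y ∷ ys} (there x∈)  px≡false =
    trans (cong (p y ∧_) (all-false p x∈ px≡false)) (Bool.∧-zeroʳ (p y))

  countᵇ-none : (p : ℕ → Bool) (xs : List ℕ) → All (λ x → p x ≡ false) xs → countᵇ p xs ≡ 0
  countᵇ-none p []       []            = refl
  countᵇ-none p (x ∷ xs) (px≡false ∷ e) =
    trans (countᵇ-∷ p x xs) (cong₂ _+_ (cong ⟦_⟧ px≡false) (countᵇ-none p xs e))

  isFubiniFrom-withOnes : (j : ℕ) (s : List Bool) (β : List ℕ) → All (1 ≤_) β →
    isFubiniFromᵇ (suc j) (withOnes s β) ≡ ((ones s ≡ᵇ 0) ∨ (j ≡ᵇ 0)) ∧ isFubiniFromᵇ (j + ones s) β
  isFubiniFrom-withOnes j s β β≥1 = trans (all-withOnes p s β)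
    (cong₂ _∧_ (cong ((ones s ≡ᵇ 0) ∨_) at-1) (all-congᴬ _ _ β (All.map at-suc β≥1)))
    where
    α = withOnes s β
    p : ℕ → Bool
    p a = a ≡ᵇ suc j + countᵇ (λ b → b <ᵇ a) α
    below-1 : countᵇ (λ b → b <ᵇ 1) α ≡ 0
    below-1 = trans (count-withOnes _ s β)
      (cong₂ _+_ (*-zeroʳ (ones s)) (countᵇ-none _ β (All.map (λ _ → refl) β≥1)))
    at-1 : p 1 ≡ (j ≡ᵇ 0)
    at-1 = trans (cong (λ c → 1 ≡ᵇ suc j + c) below-1) (1≡ᵇ1+ j)
      where
      1≡ᵇ1+ : ∀ i → (1 ≡ᵇ suc i + 0) ≡ (i ≡ᵇ 0)
      1≡ᵇ1+ zero    = refl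
      1≡ᵇ1+ (suc i) = refl
    at-suc : ∀ {x} → 1 ≤ x → p (suc x) ≡ (x ≡ᵇ j + ones s + countᵇ (λ b → b <ᵇ x) β)
    at-suc {suc x} _ = cong (λ c → suc x ≡ᵇ c) (begin
        j + countᵇ (λ b → b <ᵇ suc (suc x)) α
      ≡⟨ cong (j +_) (count-withOnes _ s β) ⟩
        j + (ones s * 1 + countᵇ (λ b → b <ᵇ suc x) β)
      ≡⟨ cong (λ t → j + (t + countᵇ (λ b → b <ᵇ suc x) β)) (*-identityʳ (ones s)) ⟩
        j + (ones s + countᵇ (λ b → b <ᵇ suc x) β)
      ≡⟨ +-assoc j (ones s) _ ⟨
        j + ones s + countᵇ (λ b → b <ᵇ suc x) β
      ∎)
      where open ≡-Reasoning

  isUnit-withOnes : (s : List Bool) (β : List ℕ) → All (1 ≤_) β →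
    isUnitᵇ (withOnes s β) ≡ (ones s ≤ᵇ 2) ∧ isUnitᵇ β
  isUnit-withOnes s β β≥1 = trans (all-withOnes p s β)
    (cong₂ _∧_ at-1 (all-congᴬ _ _ β (All.map at-suc β≥1)))
    where
    α = withOnes s β
    p : ℕ → Bool
    p a = countᵇ (λ b → b ≡ᵇ a) α ≤ᵇ 2
    p1 : p 1 ≡ (ones s ≤ᵇ 2)
    p1 = cong (_≤ᵇ 2) (trans (count-withOnes _ s β)
      (trans (cong₂ _+_ (*-identityʳ (ones s)) (countᵇ-none _ β (All.map (λ { {suc b} _ → refl }) β≥1)))
             (+-identityʳ (ones s))))
    at-1 : ((ones s ≡ᵇ 0) ∨ p 1) ≡ (ones s ≤ᵇ 2)
    at-1 with ones s | p1
    ... | zero  | _  = refl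
    ... | suc t | e  = e
    at-suc : ∀ {x} → 1 ≤ x → p (suc x) ≡ (countᵇ (λ b → b ≡ᵇ x) β ≤ᵇ 2)
    at-suc {suc x} _ = cong (_≤ᵇ 2)
      (trans (count-withOnes _ s β) (cong (_+ countᵇ (λ b → b ≡ᵇ suc x) β) (*-zeroʳ (ones s))))

  -- 1 if a unit ranking with ranks from suc j may have t entries 1, else 0
  blockWeight : ℕ → ℕ → ℕ
  blockWeight j t = ⟦ (t ≤ᵇ 2) ∧ ((t ≡ᵇ 0) ∨ (j ≡ᵇ 0)) ⟧

  ⟦∧⟧ : (x y : Bool) → ⟦ x ∧ y ⟧ ≡ ⟦ x ⟧ * ⟦ y ⟧
  ⟦∧⟧ true  y = sym (+-identityʳ ⟦ y ⟧)
  ⟦∧⟧ false y = refl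

  isUFRFrom-withOnes : (j : ℕ) (s : List Bool) (β : List ℕ) → All (1 ≤_) β →
    ⟦ isUFRFromᵇ (suc j) (withOnes s β) ⟧ ≡ blockWeight j (ones s) * ⟦ isUFRFromᵇ (j + ones s) β ⟧
  isUFRFrom-withOnes j s β β≥1 = begin
      ⟦ isFubiniFromᵇ (suc j) (withOnes s β) ∧ isUnitᵇ (withOnes s β) ⟧
    ≡⟨ cong ⟦_⟧ (cong₂ _∧_ (isFubiniFrom-withOnes j s β β≥1) (isUnit-withOnes s β β≥1)) ⟩
      ⟦ (first ∧ isFubiniFromᵇ (j + ones s) β) ∧ ((ones s ≤ᵇ 2) ∧ isUnitᵇ β) ⟧
    ≡⟨ cong ⟦_⟧ (trans (∧-CS.interchange first _ (ones s ≤ᵇ 2) _)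
                       (cong (_∧ isUFRFromᵇ (j + ones s) β) (Bool.∧-comm first (ones s ≤ᵇ 2)))) ⟩
      ⟦ ((ones s ≤ᵇ 2) ∧ first) ∧ isUFRFromᵇ (j + ones s) β ⟧
    ≡⟨ ⟦∧⟧ ((ones s ≤ᵇ 2) ∧ first) (isUFRFromᵇ (j + ones s) β) ⟩
      blockWeight j (ones s) * ⟦ isUFRFromᵇ (j + ones s) β ⟧
    ∎
    where
    open ≡-Reasoning
    first = (ones s ≡ᵇ 0) ∨ (j ≡ᵇ 0)

  distinctValues-withOnes : (N : ℕ) (s : List Bool) (β : List ℕ) → All (1 ≤_) β →
    distinctValues (suc N) (withOnes s β) ≡ ⟦ not (ones s ≡ᵇ 0) ⟧ + distinctValues N β
  distinctValues-withOnes N s β β≥1 = trans (∑-upTo-suc N _)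
    (cong₂ _+_ (cong ⟦_⟧ (occupied-withOnes-1 s β β≥1))
               (∑-cong (upTo N) (λ w → cong ⟦_⟧ (occupied-withOnes-suc w s β))))

  <ᵇ-≡-false : ∀ {m n} → n ≤ m → (m <ᵇ n) ≡ false
  <ᵇ-≡-false {m}     {zero}  _          = refl
  <ᵇ-≡-false {suc m} {suc n} (s≤s n≤m) = <ᵇ-≡-false n≤m

  -- the least entry m would have rank 0 + #{b < m} = 0
  isFubiniFrom0-∷ : (a : ℕ) (α : List ℕ) → All (1 ≤_) (a ∷ α) → isFubiniFromᵇ 0 (a ∷ α) ≡ false
  isFubiniFrom0-∷ a α (a≥1 ∷ α≥1) = all-false _ m∈ (trans (cong (m ≡ᵇ_) nothing-below-m) m≢0)
    where
    m = min a α
    m∈ : m ∈ a ∷ α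
    m∈ with argmin-sel (λ x → x) a α
    ... | inj₁ m≡a = here m≡a
    ... | inj₂ m∈α = there m∈α
    nothing-below-m : countᵇ (λ b → b <ᵇ m) (a ∷ α) ≡ 0
    nothing-below-m = countᵇ-none _ (a ∷ α) (All.map <ᵇ-≡-false (min≤⊤ a α ∷ min≤xs a α))
    m≢0 : (m ≡ᵇ 0) ≡ false
    m≢0 with m | v≤min⁺ {v = 1} a≥1 α≥1
    ... | suc _ | _ = refl

module Recurrences where

  open Sums
  open Masks
  open WithOnes
  open ShiftedRankings
  open import Data.Bool using (_∧_; not)
  open import Data.Nat using (ℕ; suc; _+_; _*_; _∸_; _≤_; _≡ᵇ_; z≤n; s≤s)
  open import Data.Nat.Properties
  open import Data.Nat.Combinatorics using (_C_; nC1≡n)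
  open import Data.List using (List; _∷_; upTo)
  open import Data.List.Relation.Unary.All as All using (All; _∷_)
  open import Data.Product using (proj₁)
  open import Relation.Binary.PropositionalEquality
  open import Data.Nat.Tactic.RingSolver using (solve-∀)

  ufrCount : ℕ → ℕ → ℕ → ℕ
  ufrCount j n k = ∑[ α ∈ tuples k n ] ⟦ isUFRFromᵇ j α ⟧

  ufrDistinctSum : ℕ → ℕ → ℕ → ℕ
  ufrDistinctSum j n k = ∑[ α ∈ tuples k n ] ⟦ isUFRFromᵇ j α ⟧ * distinctValues n α

  tuples-positive : (k n : ℕ) → All (All (1 ≤_)) (tuples k n)
  tuples-positive k n = All.map (All.map proj₁) (tuples-entries k n)

  ufrCount-suc : (j n k : ℕ) → ufrCount (suc j) (suc n) k ≡
      blockWeight j 0 * ufrCount (j + 0) n k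
    + (k C 1) * (blockWeight j 1 * ufrCount (j + 1) n (k ∸ 1))
    + (k C 2) * (blockWeight j 2 * ufrCount (j + 2) n (k ∸ 2))
  ufrCount-suc j n k = begin
      ufrCount (suc j) (suc n) k
    ≡⟨ ∑-tuples-byOnes k n (λ α → ⟦ isUFRFromᵇ (suc j) α ⟧) ⟩
      (∑[ s ∈ masks k ] ∑[ β ∈ tuples (zeros s) n ] ⟦ isUFRFromᵇ (suc j) (withOnes s β) ⟧)
    ≡⟨ ∑-cong (masks k) perMask ⟩
      (∑[ s ∈ masks k ] blockWeight j (ones s) * ufrCount (j + ones s) n (zeros s))
    ≡⟨ ∑-masks-byOnes≤2 k (λ t m → blockWeight j t * ufrCount (j + t) n m) (λ _ _ → refl) ⟩
      blockWeight j 0 * ufrCount (j + 0) n k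
        + (k C 1) * (blockWeight j 1 * ufrCount (j + 1) n (k ∸ 1))
        + (k C 2) * (blockWeight j 2 * ufrCount (j + 2) n (k ∸ 2))
    ∎
    where
    open ≡-Reasoning
    perMask : ∀ s → (∑[ β ∈ tuples (zeros s) n ] ⟦ isUFRFromᵇ (suc j) (withOnes s β) ⟧)
                    ≡ blockWeight j (ones s) * ufrCount (j + ones s) n (zeros s)
    perMask s = trans
      (∑-congᴬ (tuples (zeros s) n) (All.map (λ {β} → isUFRFrom-withOnes j s β) (tuples-positive (zeros s) n)))
      (∑-*ˡ (blockWeight j (ones s)) (tuples (zeros s) n) (λ β → ⟦ isUFRFromᵇ (j + ones s) β ⟧))

  ufrDistinctSum-suc : (j n k : ℕ) → ufrDistinctSum (suc j) (suc n) k ≡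
      blockWeight j 0 * (0 * ufrCount (j + 0) n k + ufrDistinctSum (j + 0) n k)
    + (k C 1) * (blockWeight j 1 * (1 * ufrCount (j + 1) n (k ∸ 1) + ufrDistinctSum (j + 1) n (k ∸ 1)))
    + (k C 2) * (blockWeight j 2 * (1 * ufrCount (j + 2) n (k ∸ 2) + ufrDistinctSum (j + 2) n (k ∸ 2)))
  ufrDistinctSum-suc j n k = begin
      ufrDistinctSum (suc j) (suc n) k
    ≡⟨ ∑-tuples-byOnes k n (λ α → ⟦ isUFRFromᵇ (suc j) α ⟧ * distinctValues (suc n) α) ⟩
      (∑[ s ∈ masks k ] ∑[ β ∈ tuples (zeros s) n ]
         ⟦ isUFRFromᵇ (suc j) (withOnes s β) ⟧ * distinctValues (suc n) (withOnes s β))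
    ≡⟨ ∑-cong (masks k) perMask ⟩
      (∑[ s ∈ masks k ] F (ones s) (zeros s))
    ≡⟨ ∑-masks-byOnes≤2 k F (λ _ _ → refl) ⟩
      F 0 k + (k C 1) * F 1 (k ∸ 1) + (k C 2) * F 2 (k ∸ 2)
    ∎
    where
    open ≡-Reasoning
    F : ℕ → ℕ → ℕ
    F t m = blockWeight j t * (⟦ not (t ≡ᵇ 0) ⟧ * ufrCount (j + t) n m + ufrDistinctSum (j + t) n m)
    summand : ∀ s β → All (1 ≤_) β →
      ⟦ isUFRFromᵇ (suc j) (withOnes s β) ⟧ * distinctValues (suc n) (withOnes s β)
        ≡ blockWeight j (ones s) * (⟦ not (ones s ≡ᵇ 0) ⟧ * ⟦ isUFRFromᵇ (j + ones s) β ⟧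
                                    + ⟦ isUFRFromᵇ (j + ones s) β ⟧ * distinctValues n β)
    summand s β β≥1 = trans (cong₂ _*_ (isUFRFrom-withOnes j s β β≥1) (distinctValues-withOnes n s β β≥1))
                            (regroup (blockWeight j (ones s)) ⟦ isUFRFromᵇ (j + ones s) β ⟧ ⟦ not (ones s ≡ᵇ 0) ⟧ (distinctValues n β))
      where
      regroup : ∀ w u c d → w * u * (c + d) ≡ w * (c * u + u * d)
      regroup = solve-∀
    perMask : ∀ s → (∑[ β ∈ tuples (zeros s) n ]
                       ⟦ isUFRFromᵇ (suc j) (withOnes s β) ⟧ * distinctValues (suc n) (withOnes s β))
                    ≡ F (ones s) (zeros s)
    perMask s = begin
        _
      ≡⟨ ∑-congᴬ (tuples (zeros s) n) (All.map (λ {β} → summand s β) (tuples-positive (zeros s) n)) ⟩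
        (∑[ β ∈ tuples (zeros s) n ] w * (c * ⟦ isUFRFromᵇ (j + t) β ⟧ + ⟦ isUFRFromᵇ (j + t) β ⟧ * distinctValues n β))
      ≡⟨ ∑-*ˡ w (tuples (zeros s) n) _ ⟩
        w * (∑[ β ∈ tuples (zeros s) n ] (c * ⟦ isUFRFromᵇ (j + t) β ⟧ + ⟦ isUFRFromᵇ (j + t) β ⟧ * distinctValues n β))
      ≡⟨ cong (w *_) (trans (∑-+ (tuples (zeros s) n) (λ β → c * ⟦ isUFRFromᵇ (j + t) β ⟧) _)
                            (cong (_+ ufrDistinctSum (j + t) n (zeros s))
                                  (∑-*ˡ c (tuples (zeros s) n) (λ β → ⟦ isUFRFromᵇ (j + t) β ⟧)))) ⟩
        F t (zeros s)
      ∎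
      where
      t = ones s
      w = blockWeight j t
      c = ⟦ not (t ≡ᵇ 0) ⟧

  ∑-ufrFrom0≡0 : (k n : ℕ) (f : List ℕ → ℕ) → (∑[ α ∈ tuples (suc k) n ] ⟦ isUFRFromᵇ 0 α ⟧ * f α) ≡ 0
  ∑-ufrFrom0≡0 k n f = trans (∑-tuples-suc k n (λ α → ⟦ isUFRFromᵇ 0 α ⟧ * f α))
    (trans (∑-cong (upTo n) (λ a → trans (∑-congᴬ (tuples k n) (All.map (λ {α} → vanishes a α) (tuples-positive k n)))
                                        (∑-zero (tuples k n))))
           (∑-zero (upTo n)))
    where
    vanishes : ∀ a α → All (1 ≤_) α → ⟦ isUFRFromᵇ 0 (suc a ∷ α) ⟧ * f (suc a ∷ α) ≡ 0
    vanishes a α α≥1 =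
      cong (λ b → ⟦ b ∧ isUnitᵇ (suc a ∷ α) ⟧ * f (suc a ∷ α)) (isFubiniFrom0-∷ (suc a) α (s≤s z≤n ∷ α≥1))

  ufrCount-from0 : (n k : ℕ) → ufrCount 0 n (suc k) ≡ 0
  ufrCount-from0 n k = trans (∑-cong (tuples (suc k) n) (λ α → sym (*-identityʳ ⟦ isUFRFromᵇ 0 α ⟧)))
                             (∑-ufrFrom0≡0 k n (λ _ → 1))

  ufrDistinctSum-from0 : (n k : ℕ) → ufrDistinctSum 0 n (suc k) ≡ 0
  ufrDistinctSum-from0 n k = ∑-ufrFrom0≡0 k n (distinctValues n)

  ufrCount-shift : (n k : ℕ) → ufrCount 2 (suc n) k ≡ ufrCount 1 n k
  ufrCount-shift n k = trans (ufrCount-suc 1 n k) (lemma (ufrCount 1 n k) (k C 1) (k C 2))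
    where
    lemma : ∀ a b c → 1 * a + b * 0 + c * 0 ≡ a
    lemma = solve-∀

  ufrDistinctSum-shift : (n k : ℕ) → ufrDistinctSum 2 (suc n) k ≡ ufrDistinctSum 1 n k
  ufrDistinctSum-shift n k = trans (ufrDistinctSum-suc 1 n k) (lemma (ufrDistinctSum 1 n k) (k C 1) (k C 2))
    where
    lemma : ∀ a b c → 1 * (0 + a) + b * 0 + c * 0 ≡ a
    lemma = solve-∀

  ufrCard ufrDistinctTotal : ℕ → ℕ
  ufrCard n = ufrCount 1 n n
  ufrDistinctTotal n = ufrDistinctSum 1 n n

  ufrCard-rec : (n : ℕ) → ufrCard (2 + n) ≡ (2 + n) * ufrCard (1 + n) + ((2 + n) C 2) * ufrCard n
  ufrCard-rec n = begin
      ufrCard (2 + n)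
    ≡⟨ ufrCount-suc 0 (1 + n) (2 + n) ⟩
      1 * ufrCount 0 (1 + n) (2 + n) + ((2 + n) C 1) * (1 * ufrCard (1 + n))
        + ((2 + n) C 2) * (1 * ufrCount 2 (1 + n) n)
    ≡⟨ cong₂ _+_ (cong₂ _+_ (cong (1 *_) (ufrCount-from0 (1 + n) (1 + n))) (cong (_* (1 * ufrCard (1 + n))) (nC1≡n (2 + n))))
                 (cong (λ c → ((2 + n) C 2) * (1 * c)) (ufrCount-shift n n)) ⟩
      1 * 0 + (2 + n) * (1 * ufrCard (1 + n)) + ((2 + n) C 2) * (1 * ufrCard n)
    ≡⟨ lemma (2 + n) (ufrCard (1 + n)) ((2 + n) C 2) (ufrCard n) ⟩
      (2 + n) * ufrCard (1 + n) + ((2 + n) C 2) * ufrCard n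
    ∎
    where
    open ≡-Reasoning
    lemma : ∀ a b c d → 1 * 0 + a * (1 * b) + c * (1 * d) ≡ a * b + c * d
    lemma = solve-∀

  ufrDistinctTotal-rec : (n : ℕ) → ufrDistinctTotal (2 + n) ≡
    (2 + n) * (ufrCard (1 + n) + ufrDistinctTotal (1 + n)) + ((2 + n) C 2) * (ufrCard n + ufrDistinctTotal n)
  ufrDistinctTotal-rec n = begin
      ufrDistinctTotal (2 + n)
    ≡⟨ ufrDistinctSum-suc 0 (1 + n) (2 + n) ⟩
      1 * (0 * ufrCount 0 (1 + n) (2 + n) + ufrDistinctSum 0 (1 + n) (2 + n))
        + ((2 + n) C 1) * (1 * (1 * ufrCard (1 + n) + ufrDistinctTotal (1 + n)))
        + ((2 + n) C 2) * (1 * (1 * ufrCount 2 (1 + n) n + ufrDistinctSum 2 (1 + n) n))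
    ≡⟨ cong₂ _+_ (cong₂ _+_ (cong (λ d → 1 * (0 * ufrCount 0 (1 + n) (2 + n) + d)) (ufrDistinctSum-from0 (1 + n) (1 + n)))
                            (cong (_* (1 * (1 * ufrCard (1 + n) + ufrDistinctTotal (1 + n)))) (nC1≡n (2 + n))))
                 (cong₂ (λ c d → ((2 + n) C 2) * (1 * (1 * c + d))) (ufrCount-shift n n) (ufrDistinctSum-shift n n)) ⟩
      1 * (0 * ufrCount 0 (1 + n) (2 + n) + 0) + (2 + n) * (1 * (1 * ufrCard (1 + n) + ufrDistinctTotal (1 + n)))
        + ((2 + n) C 2) * (1 * (1 * ufrCard n + ufrDistinctTotal n))
    ≡⟨ lemma (ufrCount 0 (1 + n) (2 + n)) (2 + n) (ufrCard (1 + n)) (ufrDistinctTotal (1 + n))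
             ((2 + n) C 2) (ufrCard n) (ufrDistinctTotal n) ⟩
      (2 + n) * (ufrCard (1 + n) + ufrDistinctTotal (1 + n)) + ((2 + n) C 2) * (ufrCard n + ufrDistinctTotal n)
    ∎
    where
    open ≡-Reasoning
    lemma : ∀ z a b c d e f → 1 * (0 * z + 0) + a * (1 * (1 * b + c)) + d * (1 * (1 * e + f)) ≡ a * (b + c) + d * (e + f)
    lemma = solve-∀

module Parking where

  open Sums
  open Masks
  open WithOnes
  open ShiftedRankings
  open import Data.Bool using (Bool; true; false; _∧_; _∨_; not; T)
  import Data.Bool.Properties as Bool
  open import Data.Nat using (ℕ; zero; suc; _+_; _≤_; _<_; _<ᵇ_; _≡ᵇ_; _≤ᵇ_; z≤n; s≤s)
  open import Data.Nat.Properties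
  open import Data.List using (List; []; _∷_; upTo; _++_)
  open import Data.Empty using (⊥-elim)
  open import Data.Product using (_×_; _,_; proj₁; proj₂)
  open import Data.List.Relation.Unary.All using (All; []; _∷_)
  open import Data.List.Properties using (++-identityʳ)
  open import Data.Bool.ListAction using (all)
  open import Data.List.Relation.Unary.Any using (here; there)
  open import Data.List.Membership.Propositional using (_∈_)
  open import Function.Bundles using (Equivalence)
  open import Relation.Binary.PropositionalEquality
  open import Relation.Nullary using (¬_; yes; no)
  open import Data.Nat.Tactic.RingSolver using (solve-∀)

  cnt : ℕ → List ℕ → ℕ
  cnt v xs = countᵇ (λ b → b ≡ᵇ v) xs

  cnt-∷ : (v a : ℕ) (xs : List ℕ) → cnt v (a ∷ xs) ≡ ⟦ a ≡ᵇ v ⟧ + cnt v xs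
  cnt-∷ v = countᵇ-∷ (λ b → b ≡ᵇ v)

  ≡ᵇ-refl : (a : ℕ) → (a ≡ᵇ a) ≡ true
  ≡ᵇ-refl zero    = refl
  ≡ᵇ-refl (suc a) = ≡ᵇ-refl a

  ≡ᵇ-≡-false : {a b : ℕ} → ¬ a ≡ b → (a ≡ᵇ b) ≡ false
  ≡ᵇ-≡-false {a} {b} a≢b with a ≡ᵇ b in eq
  ... | false = refl
  ... | true  = ⊥-elim (a≢b (≡ᵇ⇒≡ a b (subst T (sym eq) _)))

  occupied≡0<cnt : (v : ℕ) (xs : List ℕ) → occupied v xs ≡ (0 <ᵇ cnt v xs)
  occupied≡0<cnt v []       = refl
  occupied≡0<cnt v (x ∷ xs) with x ≡ᵇ v
  ... | true  = refl
  ... | false = occupied≡0<cnt v xs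

  -- spot v is taken by the second car of a rank that occurs twice, the rank being v ∸ 1
  secondOfPair : ℕ → List ℕ → Bool
  secondOfPair zero    P = false
  secondOfPair (suc v) P = 2 ≤ᵇ cnt v P

  -- P lists the cars that have already parked, the latest first
  ParkingInvariant : List ℕ → List ℕ → Set
  ParkingInvariant P os = ∀ v → occupied v os ≡ occupied v P ∨ secondOfPair v P

  AtMostTwice : List ℕ → List ℕ → Set
  AtMostTwice P R = ∀ v → cnt v P + cnt v R ≤ 2

  PairSkipsNext : List ℕ → List ℕ → Set
  PairSkipsNext P R = ∀ v → 2 ≤ cnt v P + cnt v R → cnt (suc v) P + cnt (suc v) R ≡ 0

  newCount : List ℕ → List ℕ → ℕ
  newCount P []      = 0
  newCount P (a ∷ R) = ⟦ not (occupied a P) ⟧ + newCount (a ∷ P) R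

  cnt-move : (v a : ℕ) (P R : List ℕ) → cnt v (a ∷ P) + cnt v R ≡ cnt v P + cnt v (a ∷ R)
  cnt-move v a P R = trans (cong (_+ cnt v R) (cnt-∷ v a P))
    (trans (regroup ⟦ a ≡ᵇ v ⟧ (cnt v P) (cnt v R)) (cong (cnt v P +_) (sym (cnt-∷ v a R))))
    where
    regroup : ∀ x y z → x + y + z ≡ y + (x + z)
    regroup = solve-∀

  AtMostTwice-move : ∀ {a P R} → AtMostTwice P (a ∷ R) → AtMostTwice (a ∷ P) R
  AtMostTwice-move {a} {P} {R} two v = subst (_≤ 2) (sym (cnt-move v a P R)) (two v)

  PairSkipsNext-move : ∀ {a P R} → PairSkipsNext P (a ∷ R) → PairSkipsNext (a ∷ P) R
  PairSkipsNext-move {a} {P} {R} next v 2≤ =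
    trans (cnt-move (suc v) a P R) (next v (subst (2 ≤_) (cnt-move v a P R) 2≤))

  secondOfPair-∷-new : (a : ℕ) (P : List ℕ) → cnt a P ≡ 0 → ∀ v → secondOfPair v (a ∷ P) ≡ secondOfPair v P
  secondOfPair-∷-new a P a∉P zero    = refl
  secondOfPair-∷-new a P a∉P (suc w) with a ≟ w
  ... | yes refl = trans (cong (2 ≤ᵇ_) (trans (cnt-∷ a a P) (cong₂ (λ x y → ⟦ x ⟧ + y) (≡ᵇ-refl a) a∉P)))
                         (cong (2 ≤ᵇ_) (sym a∉P))
  ... | no a≢w   = cong (2 ≤ᵇ_) (trans (cnt-∷ w a P) (cong (λ x → ⟦ x ⟧ + cnt w P) (≡ᵇ-≡-false a≢w)))

  secondOfPair-∷-repeat : (a : ℕ) (P : List ℕ) → cnt a P ≡ 1 →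
    ∀ v → secondOfPair v (a ∷ P) ≡ (suc a ≡ᵇ v) ∨ secondOfPair v P
  secondOfPair-∷-repeat a P once zero    = refl
  secondOfPair-∷-repeat a P once (suc w) with a ≟ w
  ... | yes refl = trans (cong (2 ≤ᵇ_) (trans (cnt-∷ a a P) (cong₂ (λ x y → ⟦ x ⟧ + y) (≡ᵇ-refl a) once)))
                         (sym (cong (_∨ secondOfPair (suc a) P) (≡ᵇ-refl a)))
  ... | no a≢w   = trans (cong (2 ≤ᵇ_) (trans (cnt-∷ w a P) (cong (λ x → ⟦ x ⟧ + cnt w P) (≡ᵇ-≡-false a≢w))))
                         (sym (cong (_∨ secondOfPair (suc w) P) (≡ᵇ-≡-false (λ e → a≢w (suc-injective e)))))

  cnt-self : (a : ℕ) (xs : List ℕ) → cnt a (a ∷ xs) ≡ suc (cnt a xs)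
  cnt-self a xs = trans (cnt-∷ a a xs) (cong (λ x → ⟦ x ⟧ + cnt a xs) (≡ᵇ-refl a))

  absent⇒cnt≡0 : {v : ℕ} {P : List ℕ} → occupied v P ≡ false → cnt v P ≡ 0
  absent⇒cnt≡0 {v} {P} v∉P with cnt v P | trans (sym (occupied≡0<cnt v P)) v∉P
  ... | zero | _ = refl

  present⇒cnt≥1 : {v : ℕ} {P : List ℕ} → occupied v P ≡ true → 1 ≤ cnt v P
  present⇒cnt≥1 {v} {P} v∈P with cnt v P | trans (sym (occupied≡0<cnt v P)) v∈P
  ... | suc _ | _ = s≤s z≤n

  occupied-∷-present : {a : ℕ} {P : List ℕ} → occupied a P ≡ true → ∀ v → occupied v (a ∷ P) ≡ occupied v P
  occupied-∷-present {a} {P} a∈P v with a ≟ v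
  ... | yes refl = trans (cong (_∨ occupied a P) (≡ᵇ-refl a)) (sym a∈P)
  ... | no a≢v   = cong (_∨ occupied v P) (≡ᵇ-≡-false a≢v)

  secondOfPair-absent : (a : ℕ) (P R : List ℕ) → PairSkipsNext P (a ∷ R) → secondOfPair a P ≡ false
  secondOfPair-absent zero    P R next = refl
  secondOfPair-absent (suc w) P R next with 2 ≤ᵇ cnt w P in twice
  ... | false = refl
  ... | true  = ⊥-elim (m+1+n≢0 (cnt (suc w) P)
                  (trans (cong (cnt (suc w) P +_) (sym (cnt-self (suc w) R)))
                         (next w (≤-trans (≤ᵇ⇒≤ 2 (cnt w P) (subst T (sym twice) _)) (m≤m+n (cnt w P) (cnt w (suc w ∷ R)))))))

  parks-at : (m a : ℕ) (os R : List ℕ) → occupied a os ≡ false →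
    parkLucky m os (a ∷ R) ≡ suc (parkLucky m (a ∷ os) R)
  parks-at m a os R a-free rewrite a-free = refl

  firstFree-next : (n a : ℕ) (os : List ℕ) → occupied a os ≡ true → occupied (suc a) os ≡ false →
    firstFree (suc (suc n)) a os ≡ (true , suc a)
  firstFree-next n a os a-taken next-free rewrite a-taken | next-free = refl

  parks-next : (n a : ℕ) (os R : List ℕ) → occupied a os ≡ true → occupied (suc a) os ≡ false →
    parkLucky (suc n) os (a ∷ R) ≡ parkLucky (suc n) (suc a ∷ os) R
  parks-next n a os R a-taken next-free rewrite a-taken | firstFree-next n a os a-taken next-free = refl

  parkLucky≡newCount : (n : ℕ) (P os R : List ℕ) → ParkingInvariant P os → AtMostTwice P R → PairSkipsNext P R →
    parkLucky (suc n) os R ≡ newCount P R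
  parkLucky≡newCount n P os []      inv two next = refl
  parkLucky≡newCount n P os (a ∷ R) inv two next with occupied a P in a∈P
  ... | false = trans (parks-at (suc n) a os R a-free)
    (cong suc (parkLucky≡newCount n (a ∷ P) (a ∷ os) R inv′ (AtMostTwice-move {a} {P} {R} two) (PairSkipsNext-move {a} {P} {R} next)))
    where
    a-free : occupied a os ≡ false
    a-free = trans (inv a) (cong₂ _∨_ a∈P (secondOfPair-absent a P R next))
    inv′ : ParkingInvariant (a ∷ P) (a ∷ os)
    inv′ v = trans (cong ((a ≡ᵇ v) ∨_) (inv v))
      (trans (sym (Bool.∨-assoc (a ≡ᵇ v) _ _))
             (cong (occupied v (a ∷ P) ∨_) (sym (secondOfPair-∷-new a P (absent⇒cnt≡0 {a} {P} a∈P) v))))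
  ... | true = trans (parks-next n a os R a-taken next-free)
    (parkLucky≡newCount n (a ∷ P) (suc a ∷ os) R inv′ (AtMostTwice-move {a} {P} {R} two) (PairSkipsNext-move {a} {P} {R} next))
    where
    a-taken : occupied a os ≡ true
    a-taken = trans (inv a) (cong (_∨ secondOfPair a P) a∈P)
    a-twice : 2 ≤ cnt a P + cnt a (a ∷ R)
    a-twice = subst (λ c → 2 ≤ cnt a P + c) (sym (cnt-self a R))
                    (+-mono-≤ (present⇒cnt≥1 {a} {P} a∈P) (s≤s z≤n))
    a-once : cnt a P ≡ 1
    a-once = ≤-antisym (m+n≤o⇒m≤o (cnt a P) {cnt a R} (≤-pred (subst (_≤ 2) (trans (cong (cnt a P +_) (cnt-self a R)) (+-suc (cnt a P) (cnt a R))) (two a))))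
                       (present⇒cnt≥1 {a} {P} a∈P)
    next-free : occupied (suc a) os ≡ false
    next-free = trans (inv (suc a)) (cong₂ _∨_ (trans (occupied≡0<cnt (suc a) P) (cong (0 <ᵇ_) (m+n≡0⇒m≡0 (cnt (suc a) P) (next a a-twice))))
                                               (cong (2 ≤ᵇ_) a-once))
    inv′ : ParkingInvariant (a ∷ P) (suc a ∷ os)
    inv′ v = trans (cong ((suc a ≡ᵇ v) ∨_) (inv v))
      (trans (∨-CS.x∙yz≈y∙xz (suc a ≡ᵇ v) (occupied v P) (secondOfPair v P))
             (cong₂ _∨_ (sym (occupied-∷-present {a} {P} a∈P v)) (sym (secondOfPair-∷-repeat a P a-once v))))

  all-T : (p : ℕ → Bool) {x : ℕ} (xs : List ℕ) → T (all p xs) → x ∈ xs → T (p x)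
  all-T p (y ∷ ys) h (here refl) = proj₁ (Equivalence.to Bool.T-∧ h)
  all-T p (y ∷ ys) h (there x∈)  = all-T p ys (proj₂ (Equivalence.to Bool.T-∧ h)) x∈

  cnt≥1⇒∈ : (v : ℕ) (xs : List ℕ) → 1 ≤ cnt v xs → v ∈ xs
  cnt≥1⇒∈ v (x ∷ xs) 1≤ with x ≡ᵇ v in x≡v
  ... | true  = here (sym (≡ᵇ⇒≡ x v (subst T (sym x≡v) _)))
  ... | false = there (cnt≥1⇒∈ v xs 1≤)

  count-<ᵇ-suc : (v : ℕ) (xs : List ℕ) → countᵇ (λ b → b <ᵇ suc v) xs ≡ countᵇ (λ b → b <ᵇ v) xs + cnt v xs
  count-<ᵇ-suc v []       = refl
  count-<ᵇ-suc v (x ∷ xs) = begin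
      countᵇ (λ b → b <ᵇ suc v) (x ∷ xs)
    ≡⟨ countᵇ-∷ (λ b → b <ᵇ suc v) x xs ⟩
      ⟦ x <ᵇ suc v ⟧ + countᵇ (λ b → b <ᵇ suc v) xs
    ≡⟨ cong₂ _+_ (split x v) (count-<ᵇ-suc v xs) ⟩
      (⟦ x <ᵇ v ⟧ + ⟦ x ≡ᵇ v ⟧) + (countᵇ (λ b → b <ᵇ v) xs + cnt v xs)
    ≡⟨ +-CS.interchange ⟦ x <ᵇ v ⟧ ⟦ x ≡ᵇ v ⟧ _ _ ⟩
      (⟦ x <ᵇ v ⟧ + countᵇ (λ b → b <ᵇ v) xs) + (⟦ x ≡ᵇ v ⟧ + cnt v xs)
    ≡⟨ cong₂ _+_ (countᵇ-∷ (λ b → b <ᵇ v) x xs) (cnt-∷ v x xs) ⟨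
      countᵇ (λ b → b <ᵇ v) (x ∷ xs) + cnt v (x ∷ xs)
    ∎
    where
    open ≡-Reasoning
    split : ∀ b v → ⟦ b <ᵇ suc v ⟧ ≡ ⟦ b <ᵇ v ⟧ + ⟦ b ≡ᵇ v ⟧
    split zero    zero    = refl
    split zero    (suc v) = refl
    split (suc b) zero    = refl
    split (suc b) (suc v) = split b v

  UFR⇒AtMostTwice : (α : List ℕ) → T (isUFRFromᵇ 1 α) → AtMostTwice [] α
  UFR⇒AtMostTwice α ufr v with cnt v α in c
  ... | zero  = z≤n
  ... | suc _ = subst (_≤ 2) c (≤ᵇ⇒≤ (cnt v α) 2
                  (all-T _ α (proj₂ (Equivalence.to Bool.T-∧ ufr)) (cnt≥1⇒∈ v α (subst (1 ≤_) (sym c) (s≤s z≤n)))))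

  UFR⇒PairSkipsNext : (α : List ℕ) → T (isUFRFromᵇ 1 α) → PairSkipsNext [] α
  UFR⇒PairSkipsNext α ufr v 2≤ with cnt (suc v) α in c
  ... | zero  = refl
  ... | suc _ = ⊥-elim (<⇒≱ 2≤ (≤-reflexive once))
    where
    rank : ∀ x → x ∈ α → x ≡ suc (countᵇ (λ b → b <ᵇ x) α)
    rank x x∈ = ≡ᵇ⇒≡ x _ (all-T _ α (proj₁ (Equivalence.to Bool.T-∧ ufr)) x∈)
    X = countᵇ (λ b → b <ᵇ v) α
    ranks : suc (suc X) ≡ suc (X + cnt v α)
    ranks = trans (cong suc (sym (rank v (cnt≥1⇒∈ v α (≤-trans (s≤s z≤n) 2≤)))))
                  (trans (rank (suc v) (cnt≥1⇒∈ (suc v) α (subst (1 ≤_) (sym c) (s≤s z≤n))))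
                         (cong suc (count-<ᵇ-suc v α)))
    once : cnt v α ≡ 1
    once = sym (+-cancelˡ-≡ X 1 (cnt v α) (trans (+-comm X 1) (suc-injective ranks)))

  ⟦∨⟧ : (x y : Bool) → ⟦ x ∨ y ⟧ ≡ ⟦ x ∧ not y ⟧ + ⟦ y ⟧
  ⟦∨⟧ true  true  = refl
  ⟦∨⟧ true  false = refl
  ⟦∨⟧ false y     = refl

  distinctValues-∷ : (N a : ℕ) (P : List ℕ) → 1 ≤ a → a ≤ N →
    distinctValues N (a ∷ P) ≡ ⟦ not (occupied a P) ⟧ + distinctValues N P
  distinctValues-∷ N (suc a) P _ a<N = begin
      (∑[ w ∈ upTo N ] ⟦ (a ≡ᵇ w) ∨ occupied (suc w) P ⟧)
    ≡⟨ ∑-cong (upTo N) (λ w → ⟦∨⟧ (a ≡ᵇ w) (occupied (suc w) P)) ⟩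
      (∑[ w ∈ upTo N ] (⟦ (a ≡ᵇ w) ∧ not (occupied (suc w) P) ⟧ + ⟦ occupied (suc w) P ⟧))
    ≡⟨ ∑-+ (upTo N) (λ w → ⟦ (a ≡ᵇ w) ∧ not (occupied (suc w) P) ⟧) _ ⟩
      (∑[ w ∈ upTo N ] ⟦ (a ≡ᵇ w) ∧ not (occupied (suc w) P) ⟧) + distinctValues N P
    ≡⟨ cong (_+ distinctValues N P) (∑-upTo-single (λ w → not (occupied (suc w) P)) a<N) ⟩
      ⟦ not (occupied (suc a) P) ⟧ + distinctValues N P
    ∎
    where open ≡-Reasoning

  occupied-++ : (v : ℕ) (xs ys : List ℕ) → occupied v (xs ++ ys) ≡ occupied v xs ∨ occupied v ys
  occupied-++ v []       ys = refl
  occupied-++ v (x ∷ xs) ys = trans (cong ((x ≡ᵇ v) ∨_) (occupied-++ v xs ys)) (sym (Bool.∨-assoc (x ≡ᵇ v) _ _))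

  newCount+distinctValues : (N : ℕ) (R P : List ℕ) → All (λ a → 1 ≤ a × a ≤ N) R →
    newCount P R + distinctValues N P ≡ distinctValues N (R ++ P)
  newCount+distinctValues N []      P []                 = refl
  newCount+distinctValues N (a ∷ R) P ((1≤a , a≤N) ∷ R-ok) = begin
      ⟦ new ⟧ + newCount (a ∷ P) R + distinctValues N P
    ≡⟨ +-CS.xy∙z≈y∙xz ⟦ new ⟧ (newCount (a ∷ P) R) (distinctValues N P) ⟩
      newCount (a ∷ P) R + (⟦ new ⟧ + distinctValues N P)
    ≡⟨ cong (newCount (a ∷ P) R +_) (distinctValues-∷ N a P 1≤a a≤N) ⟨
      newCount (a ∷ P) R + distinctValues N (a ∷ P)
    ≡⟨ newCount+distinctValues N R (a ∷ P) R-ok ⟩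
      distinctValues N (R ++ a ∷ P)
    ≡⟨ ∑-cong (upTo N) (λ w → cong ⟦_⟧ (occupied-move (suc w))) ⟩
      distinctValues N (a ∷ R ++ P)
    ∎
    where
    open ≡-Reasoning
    new = not (occupied a P)
    occupied-move : ∀ v → occupied v (R ++ a ∷ P) ≡ occupied v (a ∷ R ++ P)
    occupied-move v = trans (occupied-++ v R (a ∷ P))
      (trans (∨-CS.x∙yz≈y∙xz (occupied v R) (a ≡ᵇ v) (occupied v P))
             (cong ((a ≡ᵇ v) ∨_) (sym (occupied-++ v R P))))

  lucky≡distinctValues : (n : ℕ) (α : List ℕ) → All (λ a → 1 ≤ a × a ≤ n) α → T (isUFRFromᵇ 1 α) →
    lucky n α ≡ distinctValues n α
  lucky≡distinctValues zero    []      _                  _   = refl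
  lucky≡distinctValues zero    (a ∷ α) ((1≤a , a≤0) ∷ _) _   = ⊥-elim (<⇒≱ 1≤a a≤0)
  lucky≡distinctValues (suc n) α       α-ok               ufr = begin
      parkLucky (suc n) [] α
    ≡⟨ parkLucky≡newCount n [] [] α (λ { zero → refl ; (suc v) → refl })
                          (UFR⇒AtMostTwice α ufr) (UFR⇒PairSkipsNext α ufr) ⟩
      newCount [] α
    ≡⟨ trans (cong (newCount [] α +_) (∑-zero (upTo (suc n)))) (+-identityʳ (newCount [] α)) ⟨
      newCount [] α + distinctValues (suc n) []
    ≡⟨ newCount+distinctValues (suc n) α [] α-ok ⟩
      distinctValues (suc n) (α ++ [])
    ≡⟨ cong (distinctValues (suc n)) (++-identityʳ α) ⟩
      distinctValues (suc n) α
    ∎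
    where open ≡-Reasoning

module ClosedForms where

  open Sums
  open Masks
  open ShiftedRankings
  open Recurrences
  open Parking
  open WithOnes using (tuples-entries)
  open import Data.Bool using (Bool; true; false; T)
  open import Data.Nat as ℕ using (ℕ; zero; suc; _+_; _*_; _!; _≤_; z≤n; s≤s)
  open import Data.Nat.Properties
  open import Data.Nat.ListAction using (sum)
  open import Data.Nat.Combinatorics using (_C_; nC1≡n; nCk+nC[k+1]≡[n+1]C[k+1])
  open import Data.List using (List; []; _∷_; map; filterᵇ; length)
  open import Data.List.Relation.Unary.All as All using (All; []; _∷_)
  open import Data.Product using (_×_)
  open import Relation.Binary.PropositionalEquality
  open import Data.Empty using (⊥-elim)
  open import Data.Nat.Tactic.RingSolver using (solve-∀)

  length-filterᵇ : {A : Set} (p : A → Bool) (xs : List A) → length (filterᵇ p xs) ≡ (∑[ x ∈ xs ] ⟦ p x ⟧)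
  length-filterᵇ p []       = refl
  length-filterᵇ p (x ∷ xs) with p x
  ... | true  = cong suc (length-filterᵇ p xs)
  ... | false = length-filterᵇ p xs

  sum-map-filterᵇ : {A : Set} (p : A → Bool) (g : A → ℕ) (xs : List A) →
    sum (map g (filterᵇ p xs)) ≡ (∑[ x ∈ xs ] ⟦ p x ⟧ * g x)
  sum-map-filterᵇ p g []       = refl
  sum-map-filterᵇ p g (x ∷ xs) with p x
  ... | true  = cong₂ _+_ (sym (+-identityʳ (g x))) (sum-map-filterᵇ p g xs)
  ... | false = sum-map-filterᵇ p g xs

  length-UFR : (n : ℕ) → length (UFR n) ≡ ufrCard n
  length-UFR n = length-filterᵇ _ (tuples n n)

  sum-lucky-UFR : (n : ℕ) → sum (map (lucky n) (UFR n)) ≡ ufrDistinctTotal n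
  sum-lucky-UFR n = trans (sum-map-filterᵇ _ (lucky n) (tuples n n))
    (∑-congᴬ (tuples n n) (All.map (λ {α} → weighted α) (tuples-entries n n)))
    where
    weighted : ∀ α → All (λ a → 1 ≤ a × a ≤ n) α →
      ⟦ isUFRFromᵇ 1 α ⟧ * lucky n α ≡ ⟦ isUFRFromᵇ 1 α ⟧ * distinctValues n α
    weighted α α-ok with isUFRFromᵇ 1 α in ufr
    ... | false = refl
    ... | true  = cong (_+ 0) (lucky≡distinctValues n α α-ok (subst T (sym ufr) _))

  -- (1 + √3)ⁿ = powRe n + powIm n · √3
  powRe powIm : ℕ → ℕ
  powRe zero    = 1
  powRe (suc n) = powRe n + 3 * powIm n
  powIm zero    = 0
  powIm (suc n) = powRe n + powIm n

  meanNumer meanDenom : ℕ → ℕ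
  meanNumer n = 2 * n * powRe n + (3 * n + 1) * powIm n
  meanDenom n = 3 * (powRe n + powIm n)

  2*[2+n]C2 : (n : ℕ) → 2 * ((2 + n) C 2) ≡ (2 + n) * (1 + n)
  2*[2+n]C2 zero    = refl
  2*[2+n]C2 (suc n) = begin
      2 * ((3 + n) C 2)
    ≡⟨ cong (2 *_) (nCk+nC[k+1]≡[n+1]C[k+1] (2 + n) 1) ⟨
      2 * ((2 + n) C 1 + (2 + n) C 2)
    ≡⟨ *-distribˡ-+ 2 ((2 + n) C 1) _ ⟩
      2 * ((2 + n) C 1) + 2 * ((2 + n) C 2)
    ≡⟨ cong₂ (λ x y → 2 * x + y) (nC1≡n (2 + n)) (2*[2+n]C2 n) ⟩
      2 * (2 + n) + (2 + n) * (1 + n)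
    ≡⟨ regroup n ⟩
      (3 + n) * (2 + n)
    ∎
    where
    open ≡-Reasoning
    regroup : ∀ n → 2 * (2 + n) + (2 + n) * (1 + n) ≡ (3 + n) * (2 + n)
    regroup = solve-∀

  ufrCard-closed : (n : ℕ) → 2 ℕ.^ n * ufrCard n ≡ n ! * (powRe n + powIm n)
  ufrCard-closed zero          = refl
  ufrCard-closed (suc zero)    = refl
  ufrCard-closed (suc (suc n)) = begin
      2 ℕ.^ (2 + n) * ufrCard (2 + n)
    ≡⟨ cong (2 ℕ.^ (2 + n) *_) (ufrCard-rec n) ⟩
      2 ℕ.^ (2 + n) * ((2 + n) * ufrCard (1 + n) + ((2 + n) C 2) * ufrCard n)
    ≡⟨ regroup (2 ℕ.^ n) n (ufrCard (1 + n)) ((2 + n) C 2) (ufrCard n) ⟩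
      2 * (2 + n) * (2 ℕ.^ (1 + n) * ufrCard (1 + n)) + 2 * (2 * ((2 + n) C 2)) * (2 ℕ.^ n * ufrCard n)
    ≡⟨ cong₂ _+_ (cong (2 * (2 + n) *_) (ufrCard-closed (suc n)))
                 (cong₂ (λ c u → 2 * c * u) (2*[2+n]C2 n) (ufrCard-closed n)) ⟩
      2 * (2 + n) * ((1 + n) ! * (powRe (1 + n) + powIm (1 + n))) + 2 * ((2 + n) * (1 + n)) * (n ! * (powRe n + powIm n))
    ≡⟨ recurrence n (n !) (powRe n) (powIm n) ⟩
      (2 + n) ! * (powRe (2 + n) + powIm (2 + n))
    ∎
    where
    open ≡-Reasoning
    regroup : ∀ t n u₁ c u₀ → 2 * (2 * t) * ((2 + n) * u₁ + c * u₀) ≡ 2 * (2 + n) * (2 * t * u₁) + 2 * (2 * c) * (t * u₀)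
    regroup = solve-∀
    recurrence : ∀ n f p q →
      2 * (2 + n) * ((1 + n) * f * ((p + 3 * q) + (p + q))) + 2 * ((2 + n) * (1 + n)) * (f * (p + q))
        ≡ (2 + n) * ((1 + n) * f) * (((p + 3 * q) + 3 * (p + q)) + ((p + 3 * q) + (p + q)))
    recurrence = solve-∀

  ufrDistinctTotal-closed : (n : ℕ) → 3 * 2 ℕ.^ n * ufrDistinctTotal n ≡ n ! * meanNumer n
  ufrDistinctTotal-closed zero          = refl
  ufrDistinctTotal-closed (suc zero)    = refl
  ufrDistinctTotal-closed (suc (suc n)) = begin
      3 * 2 ℕ.^ (2 + n) * ufrDistinctTotal (2 + n)
    ≡⟨ cong (3 * 2 ℕ.^ (2 + n) *_) (ufrDistinctTotal-rec n) ⟩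
      3 * 2 ℕ.^ (2 + n) * ((2 + n) * (ufrCard (1 + n) + ufrDistinctTotal (1 + n)) + ((2 + n) C 2) * (ufrCard n + ufrDistinctTotal n))
    ≡⟨ regroup (2 ℕ.^ n) n (ufrCard (1 + n)) (ufrDistinctTotal (1 + n)) ((2 + n) C 2) (ufrCard n) (ufrDistinctTotal n) ⟩
      2 * (2 + n) * (3 * (2 ℕ.^ (1 + n) * ufrCard (1 + n)) + 3 * 2 ℕ.^ (1 + n) * ufrDistinctTotal (1 + n))
        + 2 * (2 * ((2 + n) C 2)) * (3 * (2 ℕ.^ n * ufrCard n) + 3 * 2 ℕ.^ n * ufrDistinctTotal n)
    ≡⟨ cong₂ _+_ (cong (2 * (2 + n) *_) (cong₂ (λ u d → 3 * u + d) (ufrCard-closed (suc n)) (ufrDistinctTotal-closed (suc n))))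
                 (cong₂ (λ c x → 2 * c * x) (2*[2+n]C2 n) (cong₂ (λ u d → 3 * u + d) (ufrCard-closed n) (ufrDistinctTotal-closed n))) ⟩
      2 * (2 + n) * (3 * ((1 + n) ! * (powRe (1 + n) + powIm (1 + n))) + (1 + n) ! * meanNumer (1 + n))
        + 2 * ((2 + n) * (1 + n)) * (3 * (n ! * (powRe n + powIm n)) + n ! * meanNumer n)
    ≡⟨ recurrence n (n !) (powRe n) (powIm n) ⟩
      (2 + n) ! * meanNumer (2 + n)
    ∎
    where
    open ≡-Reasoning
    regroup : ∀ t n u₁ d₁ c u₀ d₀ →
      3 * (2 * (2 * t)) * ((2 + n) * (u₁ + d₁) + c * (u₀ + d₀))
        ≡ 2 * (2 + n) * (3 * (2 * t * u₁) + 3 * (2 * t) * d₁) + 2 * (2 * c) * (3 * (t * u₀) + 3 * t * d₀)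
    regroup = solve-∀
    recurrence : ∀ n f p q →
      2 * (2 + n) * (3 * ((1 + n) * f * ((p + 3 * q) + (p + q)))
                     + (1 + n) * f * (2 * (1 + n) * (p + 3 * q) + (3 * (1 + n) + 1) * (p + q)))
        + 2 * ((2 + n) * (1 + n)) * (3 * (f * (p + q)) + f * (2 * n * p + (3 * n + 1) * q))
      ≡ (2 + n) * ((1 + n) * f) * (2 * (2 + n) * ((p + 3 * q) + 3 * (p + q))
                                   + (3 * (2 + n) + 1) * ((p + 3 * q) + (p + q)))
    recurrence = solve-∀

  powRe≥1 : (n : ℕ) → 1 ≤ powRe n
  powRe≥1 zero    = s≤s z≤n
  powRe≥1 (suc n) = ≤-trans (powRe≥1 n) (m≤m+n (powRe n) _)

  ufrCard≥1 : (n : ℕ) → 1 ≤ ufrCard n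
  ufrCard≥1 n with ufrCard n | ufrCard-closed n
  ... | suc _ | _         = s≤s z≤n
  ... | zero  | 2ⁿ*0≡n!*A = ⊥-elim (<⇒≱ (*-mono-≤ (1≤n! n) (≤-trans (powRe≥1 n) (m≤m+n (powRe n) (powIm n))))
                                        (≤-reflexive (trans (sym 2ⁿ*0≡n!*A) (*-zeroʳ (2 ℕ.^ n)))))

  ufrDistinctTotal-cross : (n : ℕ) → ufrDistinctTotal n * meanDenom n ≡ meanNumer n * ufrCard n
  ufrDistinctTotal-cross n = *-cancelˡ-≡ _ _ (2 ℕ.^ n * n !) {{m*n≢0 (2 ℕ.^ n) (n !) {{m^n≢0 2 n}} {{n !≢0}}}} (begin
      2 ℕ.^ n * n ! * (ufrDistinctTotal n * (3 * (powRe n + powIm n)))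
    ≡⟨ regroupˡ (2 ℕ.^ n) (n !) (ufrDistinctTotal n) (powRe n + powIm n) ⟩
      3 * 2 ℕ.^ n * ufrDistinctTotal n * (n ! * (powRe n + powIm n))
    ≡⟨ cong₂ _*_ (ufrDistinctTotal-closed n) (sym (ufrCard-closed n)) ⟩
      n ! * meanNumer n * (2 ℕ.^ n * ufrCard n)
    ≡⟨ regroupʳ (2 ℕ.^ n) (n !) (meanNumer n) (ufrCard n) ⟩
      2 ℕ.^ n * n ! * (meanNumer n * ufrCard n)
    ∎)
    where
    open ≡-Reasoning
    regroupˡ : ∀ t f d a → t * f * (d * (3 * a)) ≡ 3 * t * d * (f * a)
    regroupˡ = solve-∀
    regroupʳ : ∀ t f m u → f * m * (t * u) ≡ t * f * (m * u)
    regroupʳ = solve-∀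

module QuadraticField where

  open import Data.Nat as ℕ using (ℕ; suc)
  import Data.Nat.Properties as ℕP
  open import Data.Integer as ℤ using (+_)
  import Data.Integer.Properties as ℤP
  open import Data.Rational as ℚ using (ℚ; 0ℚ; 1ℚ; _÷_; 1/_; ≢-nonZero)
  import Data.Rational.Properties as ℚP
  import Data.Nat.Coprimality as Coprimality
  open import Level using (0ℓ)
  open import Relation.Nullary using (¬_; yes; no)
  open import Relation.Nullary.Decidable.Core using (dec⇒maybe)
  open import Relation.Binary.PropositionalEquality
  open import Data.Empty using (⊥-elim)
  import Tactic.RingSolver.Core.AlmostCommutativeRing as ACR
  open import Tactic.RingSolver using (solve-∀)

  -- The ring solver only sees through the operations of ℚ, so identities between components of
  -- ℚ(√3)-expressions are stated below with the operations of ℚ(√3) unfolded.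
  ℚ-ring : ACR.AlmostCommutativeRing 0ℓ 0ℓ
  ℚ-ring = ACR.fromCommutativeRing ℚP.+-*-commutativeRing (λ q → dec⇒maybe (0ℚ ℚP.≟ q))

  norm : ℚ√3 → ℚ
  norm (a + b √3) = a ℚ.* a ℚ.- ℕ→ℚ 3 ℚ.* (b ℚ.* b)

  ℚ√3-≡ : {x y : ℚ√3} → re x ≡ re y → im x ≡ im y → x ≡ y
  ℚ√3-≡ = cong₂ _+_√3

  ℕ→ℚ-+ : (m n : ℕ) → ℕ→ℚ (m ℕ.+ n) ≡ ℕ→ℚ m ℚ.+ ℕ→ℚ n
  ℕ→ℚ-+ m n rewrite ℚP.normalize-coprime {m} {0} (Coprimality.sym (Coprimality.1-coprimeTo m))
                  | ℚP.normalize-coprime {n} {0} (Coprimality.sym (Coprimality.1-coprimeTo n)) =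
    sym (cong₂ (λ x y → (x ℤ.+ y) ℚ./ 1) (ℤP.*-identityʳ (+ m)) (ℤP.*-identityʳ (+ n)))

  ℕ→ℚ-* : (m n : ℕ) → ℕ→ℚ (m ℕ.* n) ≡ ℕ→ℚ m ℚ.* ℕ→ℚ n
  ℕ→ℚ-* m n rewrite ℚP.normalize-coprime {m} {0} (Coprimality.sym (Coprimality.1-coprimeTo m))
                  | ℚP.normalize-coprime {n} {0} (Coprimality.sym (Coprimality.1-coprimeTo n)) =
    cong (ℚ._/ 1) (ℤP.pos-* m n)

  div-≢0 : (p q : ℚ) (q≢0 : ¬ q ≡ 0ℚ) → p div q ≡ _÷_ p q {{≢-nonZero q≢0}}
  div-≢0 p q q≢0 with q ℚP.≟ 0ℚ
  ... | yes q≡0 = ⊥-elim (q≢0 q≡0)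
  ... | no _    = refl

  div≡*1div : (p q : ℚ) → p div q ≡ p ℚ.* (1ℚ div q)
  div≡*1div p q with q ℚP.≟ 0ℚ
  ... | yes _   = sym (ℚP.*-zeroʳ p)
  ... | no q≢0 = cong (p ℚ.*_) (sym (ℚP.*-identityˡ (1/_ q {{≢-nonZero q≢0}})))

  *-1div : (q : ℚ) → ¬ q ≡ 0ℚ → q ℚ.* (1ℚ div q) ≡ 1ℚ
  *-1div q q≢0 = trans (cong (q ℚ.*_) (trans (div-≢0 1ℚ q q≢0) (ℚP.*-identityˡ _))) (ℚP.*-inverseʳ q)
    where instance _ = ≢-nonZero q≢0

  ℕ→ℚ-≢0 : (m : ℕ) → 1 ℕ.≤ m → ¬ ℕ→ℚ m ≡ 0ℚ
  ℕ→ℚ-≢0 (suc m) _ eq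
    rewrite ℚP.normalize-coprime {suc m} {0} (Coprimality.sym (Coprimality.1-coprimeTo (suc m))) with cong ℚ.↥_ eq
  ... | ()

  inv≡ : (c d : ℚ) → inv (c + d √3) ≡ (c ℚ.* (1ℚ div norm (c + d √3))) + ((ℚ.- d) ℚ.* (1ℚ div norm (c + d √3))) √3
  inv≡ c d = ℚ√3-≡ (div≡*1div c (norm (c + d √3))) (div≡*1div (ℚ.- d) (norm (c + d √3)))

  ⊘-unique : (x y w : ℚ√3) → ¬ norm y ≡ 0ℚ → w ⊗ y ≡ x → x ⊘ y ≡ w
  ⊘-unique x (c + d √3) (w₁ + w₂ √3) N≢0 refl = begin
      ((w₁ + w₂ √3) ⊗ (c + d √3)) ⊗ inv (c + d √3)
    ≡⟨ cong (((w₁ + w₂ √3) ⊗ (c + d √3)) ⊗_) (inv≡ c d) ⟩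
      ((w₁ + w₂ √3) ⊗ (c + d √3)) ⊗ ((c ℚ.* r) + ((ℚ.- d) ℚ.* r) √3)
    ≡⟨ ℚ√3-≡ (re-form w₁ w₂ c d r) (im-form w₁ w₂ c d r) ⟩
      (w₁ ℚ.* (norm (c + d √3) ℚ.* r)) + (w₂ ℚ.* (norm (c + d √3) ℚ.* r)) √3
    ≡⟨ cong (λ t → (w₁ ℚ.* t) + (w₂ ℚ.* t) √3) (*-1div (norm (c + d √3)) N≢0) ⟩
      (w₁ ℚ.* 1ℚ) + (w₂ ℚ.* 1ℚ) √3
    ≡⟨ cong₂ _+_√3 (ℚP.*-identityʳ w₁) (ℚP.*-identityʳ w₂) ⟩
      w₁ + w₂ √3
    ∎
    where
    open ≡-Reasoning
    r = 1ℚ div norm (c + d √3)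
    re-form : ∀ w₁ w₂ c d r → (w₁ ℚ.* c ℚ.+ ℕ→ℚ 3 ℚ.* (w₂ ℚ.* d)) ℚ.* (c ℚ.* r) ℚ.+ ℕ→ℚ 3 ℚ.* ((w₁ ℚ.* d ℚ.+ w₂ ℚ.* c) ℚ.* ((ℚ.- d) ℚ.* r))
                              ≡ w₁ ℚ.* ((c ℚ.* c ℚ.- ℕ→ℚ 3 ℚ.* (d ℚ.* d)) ℚ.* r)
    re-form = solve-∀ ℚ-ring
    im-form : ∀ w₁ w₂ c d r → (w₁ ℚ.* c ℚ.+ ℕ→ℚ 3 ℚ.* (w₂ ℚ.* d)) ℚ.* ((ℚ.- d) ℚ.* r) ℚ.+ (w₁ ℚ.* d ℚ.+ w₂ ℚ.* c) ℚ.* (c ℚ.* r)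
                              ≡ w₂ ℚ.* ((c ℚ.* c ℚ.- ℕ→ℚ 3 ℚ.* (d ℚ.* d)) ℚ.* r)
    im-form = solve-∀ ℚ-ring

  rescale : (y : ℚ) (k d w : ℕ) → 1 ℕ.≤ d → 1 ℕ.≤ w → y ℚ.* ℕ→ℚ d ≡ ℕ→ℚ k →
    y ≡ ℕ→ℚ (k ℕ.* w) ℚ.* (1ℚ div ℕ→ℚ (d ℕ.* w))
  rescale y k d w d≥1 w≥1 yd≡k = begin
      y
    ≡⟨ ℚP.*-identityʳ y ⟨
      y ℚ.* 1ℚ
    ≡⟨ cong (y ℚ.*_) (*-1div (ℕ→ℚ (d ℕ.* w)) (ℕ→ℚ-≢0 (d ℕ.* w) (ℕP.*-mono-≤ d≥1 w≥1))) ⟨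
      y ℚ.* (ℕ→ℚ (d ℕ.* w) ℚ.* r)
    ≡⟨ cong (λ t → y ℚ.* (t ℚ.* r)) (ℕ→ℚ-* d w) ⟩
      y ℚ.* (ℕ→ℚ d ℚ.* ℕ→ℚ w ℚ.* r)
    ≡⟨ regroup y (ℕ→ℚ d) (ℕ→ℚ w) r ⟩
      y ℚ.* ℕ→ℚ d ℚ.* ℕ→ℚ w ℚ.* r
    ≡⟨ cong (λ t → t ℚ.* ℕ→ℚ w ℚ.* r) yd≡k ⟩
      ℕ→ℚ k ℚ.* ℕ→ℚ w ℚ.* r
    ≡⟨ cong (ℚ._* r) (ℕ→ℚ-* k w) ⟨
      ℕ→ℚ (k ℕ.* w) ℚ.* r
    ∎
    where
    open ≡-Reasoning
    r = 1ℚ div ℕ→ℚ (d ℕ.* w)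
    regroup : ∀ y d w r → y ℚ.* (d ℚ.* w ℚ.* r) ≡ y ℚ.* d ℚ.* w ℚ.* r
    regroup = solve-∀ ℚ-ring

module ExactFormula where

  open QuadraticField
  open import Tactic.RingSolver using (solve-∀)
  open ClosedForms
  open Recurrences using (ufrCard; ufrDistinctTotal)
  import Data.Nat.Properties as ℕP
  open import Data.Nat as ℕ using (ℕ; zero; suc)
  open import Data.Rational as ℚ using (ℚ; 0ℚ; 1ℚ)
  import Data.Rational.Properties as ℚP
  open import Relation.Binary.PropositionalEquality

  ℕ→ℚ-3n+1 : (n : ℕ) → ℕ→ℚ (3 ℕ.* n ℕ.+ 1) ≡ ℕ→ℚ 3 ℚ.* ℕ→ℚ n ℚ.+ 1ℚ
  ℕ→ℚ-3n+1 n = trans (ℕ→ℚ-+ (3 ℕ.* n) 1) (cong (ℚ._+ 1ℚ) (ℕ→ℚ-* 3 n))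

  pow⁺ : (n : ℕ) → (one ⊕ √3) ^ n ≡ ℕ→ℚ (powRe n) + ℕ→ℚ (powIm n) √3
  pow⁺ zero    = refl
  pow⁺ (suc n) = trans (cong ((one ⊕ √3) ⊗_) (pow⁺ n)) (ℚ√3-≡
    (trans (re-step (ℕ→ℚ (powRe n)) (ℕ→ℚ (powIm n)))
           (sym (trans (ℕ→ℚ-+ (powRe n) (3 ℕ.* powIm n)) (cong (ℕ→ℚ (powRe n) ℚ.+_) (ℕ→ℚ-* 3 (powIm n))))))
    (trans (im-step (ℕ→ℚ (powRe n)) (ℕ→ℚ (powIm n))) (sym (ℕ→ℚ-+ (powRe n) (powIm n)))))
    where
    re-step : ∀ p q → (1ℚ ℚ.+ 0ℚ) ℚ.* p ℚ.+ ℕ→ℚ 3 ℚ.* ((0ℚ ℚ.+ 1ℚ) ℚ.* q) ≡ p ℚ.+ ℕ→ℚ 3 ℚ.* q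
    re-step = solve-∀ ℚ-ring
    im-step : ∀ p q → (1ℚ ℚ.+ 0ℚ) ℚ.* q ℚ.+ (0ℚ ℚ.+ 1ℚ) ℚ.* p ≡ p ℚ.+ q
    im-step = solve-∀ ℚ-ring

  pow⁻ : (n : ℕ) → (one ⊖ √3) ^ n ≡ ℕ→ℚ (powRe n) + (ℚ.- ℕ→ℚ (powIm n)) √3
  pow⁻ zero    = ℚ√3-≡ refl refl
  pow⁻ (suc n) = trans (cong ((one ⊖ √3) ⊗_) (pow⁻ n)) (ℚ√3-≡
    (trans (re-step (ℕ→ℚ (powRe n)) (ℕ→ℚ (powIm n)))
           (sym (trans (ℕ→ℚ-+ (powRe n) (3 ℕ.* powIm n)) (cong (ℕ→ℚ (powRe n) ℚ.+_) (ℕ→ℚ-* 3 (powIm n))))))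
    (trans (im-step (ℕ→ℚ (powRe n)) (ℕ→ℚ (powIm n))) (cong ℚ.-_ (sym (ℕ→ℚ-+ (powRe n) (powIm n))))))
    where
    re-step : ∀ p q → (1ℚ ℚ.+ (ℚ.- 0ℚ)) ℚ.* p ℚ.+ ℕ→ℚ 3 ℚ.* ((0ℚ ℚ.+ (ℚ.- 1ℚ)) ℚ.* (ℚ.- q)) ≡ p ℚ.+ ℕ→ℚ 3 ℚ.* q
    re-step = solve-∀ ℚ-ring
    im-step : ∀ p q → (1ℚ ℚ.+ (ℚ.- 0ℚ)) ℚ.* (ℚ.- q) ℚ.+ (0ℚ ℚ.+ (ℚ.- 1ℚ)) ℚ.* p ≡ ℚ.- (p ℚ.+ q)
    im-step = solve-∀ ℚ-ring

  ℕ→ℚ-meanNumer : (n : ℕ) → ℕ→ℚ (meanNumer n) ≡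
    ℕ→ℚ 2 ℚ.* ℕ→ℚ n ℚ.* ℕ→ℚ (powRe n) ℚ.+ (ℕ→ℚ 3 ℚ.* ℕ→ℚ n ℚ.+ 1ℚ) ℚ.* ℕ→ℚ (powIm n)
  ℕ→ℚ-meanNumer n = begin
      ℕ→ℚ (2 ℕ.* n ℕ.* powRe n ℕ.+ (3 ℕ.* n ℕ.+ 1) ℕ.* powIm n)
    ≡⟨ ℕ→ℚ-+ (2 ℕ.* n ℕ.* powRe n) ((3 ℕ.* n ℕ.+ 1) ℕ.* powIm n) ⟩
      ℕ→ℚ (2 ℕ.* n ℕ.* powRe n) ℚ.+ ℕ→ℚ ((3 ℕ.* n ℕ.+ 1) ℕ.* powIm n)
    ≡⟨ cong₂ ℚ._+_ (trans (ℕ→ℚ-* (2 ℕ.* n) (powRe n)) (cong (ℚ._* ℕ→ℚ (powRe n)) (ℕ→ℚ-* 2 n)))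
                   (trans (ℕ→ℚ-* (3 ℕ.* n ℕ.+ 1) (powIm n)) (cong (ℚ._* ℕ→ℚ (powIm n)) (ℕ→ℚ-3n+1 n))) ⟩
      ℕ→ℚ 2 ℚ.* ℕ→ℚ n ℚ.* ℕ→ℚ (powRe n) ℚ.+ (ℕ→ℚ 3 ℚ.* ℕ→ℚ n ℚ.+ 1ℚ) ℚ.* ℕ→ℚ (powIm n)
    ∎
    where open ≡-Reasoning

  ℕ→ℚ-meanDenom : (n : ℕ) → ℕ→ℚ (meanDenom n) ≡ ℕ→ℚ 3 ℚ.* (ℕ→ℚ (powRe n) ℚ.+ ℕ→ℚ (powIm n))
  ℕ→ℚ-meanDenom n = trans (ℕ→ℚ-* 3 (powRe n ℕ.+ powIm n)) (cong (ℕ→ℚ 3 ℚ.*_) (ℕ→ℚ-+ (powRe n) (powIm n)))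

  numer≡ : (n : ℕ) → numer n ≡ fromℕ (6 ℕ.* meanNumer n)
  numer≡ n = begin
      numer n
    ≡⟨ cong₂ (λ u w → ((a₃ ⊗ √3 ⊕ b₃) ⊗ u) ⊖ ((a₃ ⊗ √3 ⊖ b₃) ⊗ w)) (pow⁺ n) (pow⁻ n) ⟩
      ((a₃ ⊗ √3 ⊕ b₃) ⊗ (P + Q √3)) ⊖ ((a₃ ⊗ √3 ⊖ b₃) ⊗ (P + (ℚ.- Q) √3))
    ≡⟨ ℚ√3-≡ (re-form (ℕ→ℚ (3 ℕ.* n ℕ.+ 1)) (ℕ→ℚ (6 ℕ.* n)) P Q) (im-form (ℕ→ℚ (3 ℕ.* n ℕ.+ 1)) (ℕ→ℚ (6 ℕ.* n)) P Q) ⟩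
      fromℚ (ℕ→ℚ 2 ℚ.* ℕ→ℚ (6 ℕ.* n) ℚ.* P ℚ.+ ℕ→ℚ 6 ℚ.* ℕ→ℚ (3 ℕ.* n ℕ.+ 1) ℚ.* Q)
    ≡⟨ cong fromℚ (begin
        ℕ→ℚ 2 ℚ.* ℕ→ℚ (6 ℕ.* n) ℚ.* P ℚ.+ ℕ→ℚ 6 ℚ.* ℕ→ℚ (3 ℕ.* n ℕ.+ 1) ℚ.* Q
      ≡⟨ cong₂ (λ b a → ℕ→ℚ 2 ℚ.* b ℚ.* P ℚ.+ ℕ→ℚ 6 ℚ.* a ℚ.* Q) (ℕ→ℚ-* 6 n) (ℕ→ℚ-3n+1 n) ⟩
        ℕ→ℚ 2 ℚ.* (ℕ→ℚ 6 ℚ.* ℕ→ℚ n) ℚ.* P ℚ.+ ℕ→ℚ 6 ℚ.* (ℕ→ℚ 3 ℚ.* ℕ→ℚ n ℚ.+ 1ℚ) ℚ.* Q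
      ≡⟨ regroup (ℕ→ℚ n) P Q ⟩
        ℕ→ℚ 6 ℚ.* (ℕ→ℚ 2 ℚ.* ℕ→ℚ n ℚ.* P ℚ.+ (ℕ→ℚ 3 ℚ.* ℕ→ℚ n ℚ.+ 1ℚ) ℚ.* Q)
      ≡⟨ trans (ℕ→ℚ-* 6 (meanNumer n)) (cong (ℕ→ℚ 6 ℚ.*_) (ℕ→ℚ-meanNumer n)) ⟨
        ℕ→ℚ (6 ℕ.* meanNumer n)
      ∎) ⟩
      fromℕ (6 ℕ.* meanNumer n)
    ∎
    where
    open ≡-Reasoning
    P = ℕ→ℚ (powRe n)
    Q = ℕ→ℚ (powIm n)
    a₃ = fromℕ (3 ℕ.* n ℕ.+ 1)
    b₃ = fromℕ (6 ℕ.* n)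
    re-form : ∀ a b P Q →
      (((a ℚ.* 0ℚ ℚ.+ ℕ→ℚ 3 ℚ.* (0ℚ ℚ.* 1ℚ)) ℚ.+ b) ℚ.* P ℚ.+ ℕ→ℚ 3 ℚ.* (((a ℚ.* 1ℚ ℚ.+ 0ℚ ℚ.* 0ℚ) ℚ.+ 0ℚ) ℚ.* Q)) ℚ.+ (ℚ.- (((a ℚ.* 0ℚ ℚ.+ ℕ→ℚ 3 ℚ.* (0ℚ ℚ.* 1ℚ)) ℚ.+ (ℚ.- b)) ℚ.* P ℚ.+ ℕ→ℚ 3 ℚ.* (((a ℚ.* 1ℚ ℚ.+ 0ℚ ℚ.* 0ℚ) ℚ.+ (ℚ.- 0ℚ)) ℚ.* (ℚ.- Q))))
                          ≡ ℕ→ℚ 2 ℚ.* b ℚ.* P ℚ.+ ℕ→ℚ 6 ℚ.* a ℚ.* Q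
    re-form = solve-∀ ℚ-ring
    im-form : ∀ a b P Q →
      (((a ℚ.* 0ℚ ℚ.+ ℕ→ℚ 3 ℚ.* (0ℚ ℚ.* 1ℚ)) ℚ.+ b) ℚ.* Q ℚ.+ ((a ℚ.* 1ℚ ℚ.+ 0ℚ ℚ.* 0ℚ) ℚ.+ 0ℚ) ℚ.* P) ℚ.+ (ℚ.- (((a ℚ.* 0ℚ ℚ.+ ℕ→ℚ 3 ℚ.* (0ℚ ℚ.* 1ℚ)) ℚ.+ (ℚ.- b)) ℚ.* (ℚ.- Q) ℚ.+ ((a ℚ.* 1ℚ ℚ.+ 0ℚ ℚ.* 0ℚ) ℚ.+ (ℚ.- 0ℚ)) ℚ.* P))
                          ≡ 0ℚ
    im-form = solve-∀ ℚ-ring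
    regroup : ∀ x P Q → ℕ→ℚ 2 ℚ.* (ℕ→ℚ 6 ℚ.* x) ℚ.* P ℚ.+ ℕ→ℚ 6 ℚ.* (ℕ→ℚ 3 ℚ.* x ℚ.+ 1ℚ) ℚ.* Q
                        ≡ ℕ→ℚ 6 ℚ.* (ℕ→ℚ 2 ℚ.* x ℚ.* P ℚ.+ (ℕ→ℚ 3 ℚ.* x ℚ.+ 1ℚ) ℚ.* Q)
    regroup = solve-∀ ℚ-ring

  denom≡ : (n : ℕ) → denom n ≡ fromℕ (6 ℕ.* meanDenom n)
  denom≡ n = begin
      denom n
    ≡⟨ cong₂ (λ u w → (fromℕ 3 ⊗ (fromℕ 3 ⊕ √3) ⊗ u) ⊕ (fromℕ 3 ⊗ (fromℕ 3 ⊖ √3) ⊗ w)) (pow⁺ n) (pow⁻ n) ⟩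
      (fromℕ 3 ⊗ (fromℕ 3 ⊕ √3) ⊗ (P + Q √3)) ⊕ (fromℕ 3 ⊗ (fromℕ 3 ⊖ √3) ⊗ (P + (ℚ.- Q) √3))
    ≡⟨ ℚ√3-≡ (re-form P Q) (im-form P Q) ⟩
      fromℚ (ℕ→ℚ 6 ℚ.* (ℕ→ℚ 3 ℚ.* (P ℚ.+ Q)))
    ≡⟨ cong fromℚ (trans (ℕ→ℚ-* 6 (meanDenom n)) (cong (ℕ→ℚ 6 ℚ.*_) (ℕ→ℚ-meanDenom n))) ⟨
      fromℕ (6 ℕ.* meanDenom n)
    ∎
    where
    open ≡-Reasoning
    P = ℕ→ℚ (powRe n)
    Q = ℕ→ℚ (powIm n)
    re-form : ∀ P Q →
      (((ℕ→ℚ 3) ℚ.* ((ℕ→ℚ 3) ℚ.+ 0ℚ) ℚ.+ ℕ→ℚ 3 ℚ.* (0ℚ ℚ.* (0ℚ ℚ.+ 1ℚ))) ℚ.* P ℚ.+ ℕ→ℚ 3 ℚ.* (((ℕ→ℚ 3) ℚ.* (0ℚ ℚ.+ 1ℚ) ℚ.+ 0ℚ ℚ.* ((ℕ→ℚ 3) ℚ.+ 0ℚ)) ℚ.* Q)) ℚ.+ (((ℕ→ℚ 3) ℚ.* ((ℕ→ℚ 3) ℚ.+ (ℚ.- 0ℚ)) ℚ.+ ℕ→ℚ 3 ℚ.* (0ℚ ℚ.* (0ℚ ℚ.+ (ℚ.- 1ℚ)))) ℚ.* P ℚ.+ ℕ→ℚ 3 ℚ.* (((ℕ→ℚ 3)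 ℚ.* (0ℚ ℚ.+ (ℚ.- 1ℚ)) ℚ.+ 0ℚ ℚ.* ((ℕ→ℚ 3) ℚ.+ (ℚ.- 0ℚ))) ℚ.* (ℚ.- Q)))
                      ≡ ℕ→ℚ 6 ℚ.* (ℕ→ℚ 3 ℚ.* (P ℚ.+ Q))
    re-form = solve-∀ ℚ-ring
    im-form : ∀ P Q →
      (((ℕ→ℚ 3) ℚ.* ((ℕ→ℚ 3) ℚ.+ 0ℚ) ℚ.+ ℕ→ℚ 3 ℚ.* (0ℚ ℚ.* (0ℚ ℚ.+ 1ℚ))) ℚ.* Q ℚ.+ ((ℕ→ℚ 3) ℚ.* (0ℚ ℚ.+ 1ℚ) ℚ.+ 0ℚ ℚ.* ((ℕ→ℚ 3) ℚ.+ 0ℚ)) ℚ.* P) ℚ.+ (((ℕ→ℚ 3) ℚ.* ((ℕ→ℚ 3) ℚ.+ (ℚ.- 0ℚ)) ℚ.+ ℕ→ℚ 3 ℚ.* (0ℚ ℚ.* (0ℚ ℚ.+ (ℚ.- 1ℚ)))) ℚ.* (ℚ.- Q) ℚ.+ ((ℕ→ℚ 3) ℚ.* (0ℚ ℚ.+ (ℚ.- 1ℚ)) ℚ.+ 0ℚ ℚ.* ((ℕ→ℚ 3) ℚ.+ (ℚ.- 0ℚ))) ℚ.* P)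
                      ≡ 0ℚ
    im-form = solve-∀ ℚ-ring

  fromℚ-⊗ : (x y : ℚ) → fromℚ x ⊗ fromℚ y ≡ fromℚ (x ℚ.* y)
  fromℚ-⊗ x y = ℚ√3-≡ (re-form x y) (im-form x y)
    where
    re-form : ∀ x y → x ℚ.* y ℚ.+ ℕ→ℚ 3 ℚ.* (0ℚ ℚ.* 0ℚ) ≡ x ℚ.* y
    re-form = solve-∀ ℚ-ring
    im-form : ∀ x y → x ℚ.* 0ℚ ℚ.+ 0ℚ ℚ.* y ≡ 0ℚ
    im-form = solve-∀ ℚ-ring

  fromℕ-⊘-fromℕ : (k m : ℕ) (e : ℚ) → 1 ℕ.≤ m → e ℚ.* ℕ→ℚ m ≡ ℕ→ℚ k → fromℕ k ⊘ fromℕ m ≡ fromℚ e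
  fromℕ-⊘-fromℕ k m e m≥1 e*m≡k = ⊘-unique (fromℕ k) (fromℕ m) (fromℚ e)
    (λ N≡0 → ℕ→ℚ-≢0 (m ℕ.* m) (ℕP.*-mono-≤ m≥1 m≥1)
               (trans (ℕ→ℚ-* m m) (trans (sym (norm-fromℚ (ℕ→ℚ m))) N≡0)))
    (trans (fromℚ-⊗ e (ℕ→ℚ m)) (cong fromℚ e*m≡k))
    where
    norm-fromℚ : ∀ x → x ℚ.* x ℚ.- ℕ→ℚ 3 ℚ.* (0ℚ ℚ.* 0ℚ) ≡ x ℚ.* x
    norm-fromℚ = solve-∀ ℚ-ring

  expectedLucky-*-meanDenom : (n : ℕ) → expectedLucky n ℚ.* ℕ→ℚ (meanDenom n) ≡ ℕ→ℚ (meanNumer n)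
  expectedLucky-*-meanDenom n = begin
      expectedLucky n ℚ.* Δ
    ≡⟨ cong (ℚ._* Δ) (trans (cong₂ (λ d u → ℕ→ℚ d div ℕ→ℚ u) (sum-lucky-UFR n) (length-UFR n)) (div≡*1div D U)) ⟩
      D ℚ.* (1ℚ div U) ℚ.* Δ
    ≡⟨ swap D (1ℚ div U) Δ ⟩
      D ℚ.* Δ ℚ.* (1ℚ div U)
    ≡⟨ cong (ℚ._* (1ℚ div U)) cross ⟩
      Λ ℚ.* U ℚ.* (1ℚ div U)
    ≡⟨ ℚP.*-assoc Λ U (1ℚ div U) ⟩
      Λ ℚ.* (U ℚ.* (1ℚ div U))
    ≡⟨ cong (Λ ℚ.*_) (*-1div U (ℕ→ℚ-≢0 (ufrCard n) (ufrCard≥1 n))) ⟩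
      Λ ℚ.* 1ℚ
    ≡⟨ ℚP.*-identityʳ Λ ⟩
      Λ
    ∎
    where
    open ≡-Reasoning
    D = ℕ→ℚ (ufrDistinctTotal n)
    U = ℕ→ℚ (ufrCard n)
    Δ = ℕ→ℚ (meanDenom n)
    Λ = ℕ→ℚ (meanNumer n)
    cross : D ℚ.* Δ ≡ Λ ℚ.* U
    cross = trans (sym (ℕ→ℚ-* (ufrDistinctTotal n) (meanDenom n)))
                  (trans (cong ℕ→ℚ (ufrDistinctTotal-cross n)) (ℕ→ℚ-* (meanNumer n) (ufrCard n)))
    swap : ∀ x y z → x ℚ.* y ℚ.* z ≡ x ℚ.* z ℚ.* y
    swap = solve-∀ ℚ-ring

  expectedLucky≡numer⊘denom : (n : ℕ) → fromℚ (expectedLucky n) ≡ numer n ⊘ denom n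
  expectedLucky≡numer⊘denom n = sym (trans (cong₂ _⊘_ (numer≡ n) (denom≡ n))
    (fromℕ-⊘-fromℕ (6 ℕ.* meanNumer n) (6 ℕ.* meanDenom n) (expectedLucky n)
      (ℕP.≤-trans (powRe≥1 n) (ℕP.≤-trans (ℕP.m≤m+n (powRe n) (powIm n))
        (ℕP.≤-trans (ℕP.m≤n*m (powRe n ℕ.+ powIm n) 3) (ℕP.m≤n*m (meanDenom n) 6))))
      (begin
        expectedLucky n ℚ.* ℕ→ℚ (6 ℕ.* meanDenom n)
      ≡⟨ cong (expectedLucky n ℚ.*_) (ℕ→ℚ-* 6 (meanDenom n)) ⟩
        expectedLucky n ℚ.* (ℕ→ℚ 6 ℚ.* ℕ→ℚ (meanDenom n))
      ≡⟨ swap (expectedLucky n) (ℕ→ℚ 6) (ℕ→ℚ (meanDenom n)) ⟩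
        ℕ→ℚ 6 ℚ.* (expectedLucky n ℚ.* ℕ→ℚ (meanDenom n))
      ≡⟨ cong (ℕ→ℚ 6 ℚ.*_) (expectedLucky-*-meanDenom n) ⟩
        ℕ→ℚ 6 ℚ.* ℕ→ℚ (meanNumer n)
      ≡⟨ ℕ→ℚ-* 6 (meanNumer n) ⟨
        ℕ→ℚ (6 ℕ.* meanNumer n)
      ∎)))
    where
    open ≡-Reasoning
    swap : ∀ x y z → x ℚ.* (y ℚ.* z) ≡ y ℚ.* (x ℚ.* z)
    swap = solve-∀ ℚ-ring

module Order where

  open QuadraticField
  open import Tactic.RingSolver using (solve-∀)
  open import Data.Nat as ℕ using (ℕ; z≤n; s≤s)
  import Data.Nat.Properties as ℕP
  open import Data.Integer as ℤ using (+_)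
  import Data.Integer.Properties as ℤP
  open import Data.Rational as ℚ using (ℚ; 0ℚ; 1ℚ; *<*; *≤*)
  import Data.Rational.Properties as ℚP
  import Data.Nat.Coprimality as Coprimality
  open import Data.Sum using (inj₁; inj₂)
  open import Data.Product using (_,_)
  open import Relation.Binary.PropositionalEquality
  open import Relation.Nullary using (yes; no)

  ℕ→ℚ-mono-< : {m k : ℕ} → m ℕ.< k → ℕ→ℚ m ℚ.< ℕ→ℚ k
  ℕ→ℚ-mono-< {m} {k} m<k
    rewrite ℚP.normalize-coprime {m} {0} (Coprimality.sym (Coprimality.1-coprimeTo m))
          | ℚP.normalize-coprime {k} {0} (Coprimality.sym (Coprimality.1-coprimeTo k)) =
    *<* (subst₂ ℤ._<_ (sym (ℤP.*-identityʳ (+ m))) (sym (ℤP.*-identityʳ (+ k))) (ℤ.+<+ m<k))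

  ℕ→ℚ-mono-≤ : {m k : ℕ} → m ℕ.≤ k → ℕ→ℚ m ℚ.≤ ℕ→ℚ k
  ℕ→ℚ-mono-≤ {m} {k} m≤k
    rewrite ℚP.normalize-coprime {m} {0} (Coprimality.sym (Coprimality.1-coprimeTo m))
          | ℚP.normalize-coprime {k} {0} (Coprimality.sym (Coprimality.1-coprimeTo k)) =
    *≤* (subst₂ ℤ._≤_ (sym (ℤP.*-identityʳ (+ m))) (sym (ℤP.*-identityʳ (+ k))) (ℤ.+≤+ m≤k))

  module Multiples (s : ℚ) (s>0 : 0ℚ ℚ.< s) where

    _·s : ℕ → ℚ
    k ·s = ℕ→ℚ k ℚ.* s

    ·s-mono-< : {m k : ℕ} → m ℕ.< k → m ·s ℚ.< k ·s
    ·s-mono-< {m} {k} m<k = ℚP.*-monoˡ-<-pos s {{ℚ.positive s>0}} (ℕ→ℚ-mono-< {m} {k} m<k)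

    ·s-mono-≤ : {m k : ℕ} → m ℕ.≤ k → m ·s ℚ.≤ k ·s
    ·s-mono-≤ {m} {k} m≤k = ℚP.*-monoʳ-≤-nonNeg s {{ℚP.pos⇒nonNeg s {{ℚ.positive s>0}}}} (ℕ→ℚ-mono-≤ {m} {k} m≤k)

    ·s-pos : (k : ℕ) → 1 ℕ.≤ k → 0ℚ ℚ.< k ·s
    ·s-pos k k≥1 = subst (ℚ._< k ·s) (ℚP.*-zeroˡ s) (·s-mono-< {0} {k} k≥1)

    ·s-nonneg : (k : ℕ) → 0ℚ ℚ.≤ k ·s
    ·s-nonneg k = subst (ℚ._≤ k ·s) (ℚP.*-zeroˡ s) (·s-mono-≤ {0} {k} z≤n)

    ·s-square : (k : ℕ) → k ·s ℚ.* k ·s ≡ ℕ→ℚ (k ℕ.* k) ℚ.* (s ℚ.* s)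
    ·s-square k = trans (regroup (ℕ→ℚ k) s) (cong (ℚ._* (s ℚ.* s)) (sym (ℕ→ℚ-* k k)))
      where
      regroup : ∀ k s → k ℚ.* s ℚ.* (k ℚ.* s) ≡ k ℚ.* k ℚ.* (s ℚ.* s)
      regroup = solve-∀ ℚ-ring

  AbsLt-multiples : (s : ℚ) (s>0 : 0ℚ ℚ.< s) (A C D : ℕ) → 1 ℕ.≤ C →
    3 ℕ.* (C ℕ.* C) ℕ.< (A ℕ.+ D) ℕ.* (A ℕ.+ D) →
    (D ℕ.< A → (A ℕ.∸ D) ℕ.* (A ℕ.∸ D) ℕ.< 3 ℕ.* (C ℕ.* C)) →
    let open Multiples s s>0 in AbsLt ((A ·s) + (ℚ.- (C ·s)) √3) (D ·s)
  AbsLt-multiples s s>0 A C D C≥1 lower upper = above , below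
    where
    open Multiples s s>0
    s²>0 : 0ℚ ℚ.< s ℚ.* s
    s²>0 = subst (ℚ._< s ℚ.* s) (ℚP.*-zeroˡ s) (ℚP.*-monoˡ-<-pos s {{ℚ.positive s>0}} s>0)
    module S² = Multiples (s ℚ.* s) s²>0
    neg-square : ∀ x → ℚ.- x ℚ.* ℚ.- x ≡ x ℚ.* x
    neg-square = solve-∀ ℚ-ring
    3C² : ℕ→ℚ 3 ℚ.* (C ·s ℚ.* C ·s) ≡ (3 ℕ.* (C ℕ.* C)) S².·s
    3C² = trans (cong (ℕ→ℚ 3 ℚ.*_) (·s-square C))
                (trans (sym (ℚP.*-assoc (ℕ→ℚ 3) (ℕ→ℚ (C ℕ.* C)) (s ℚ.* s)))
                       (cong (ℚ._* (s ℚ.* s)) (sym (ℕ→ℚ-* 3 (C ℕ.* C)))))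
    C·s>0 : 0ℚ ℚ.< C ·s
    C·s>0 = ·s-pos C C≥1
    A+D>0 : 1 ℕ.≤ A ℕ.+ D
    A+D>0 = ℕP.n≢0⇒n>0 (λ A+D≡0 → ℕP.n≮0 (subst (λ t → 3 ℕ.* (C ℕ.* C) ℕ.< t ℕ.* t) A+D≡0 lower))
    above : Positive (((A ·s) + (ℚ.- (C ·s)) √3) ⊖ neg (fromℚ (D ·s)))
    above = subst Positive (sym (ℚ√3-≡ (trans (re-form (ℕ→ℚ A) (ℕ→ℚ C) (ℕ→ℚ D) s)
                                               (cong (ℚ._* s) (sym (ℕ→ℚ-+ A D))))
                                        (im-form (ℕ→ℚ A) (ℕ→ℚ C) (ℕ→ℚ D) s)))
      (inj₂ (inj₁ (·s-pos (A ℕ.+ D) A+D>0 , ℚP.neg-antimono-< C·s>0 ,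
                   subst₂ ℚ._<_ (sym (trans (cong (ℕ→ℚ 3 ℚ.*_) (neg-square (C ·s))) 3C²)) (sym (·s-square (A ℕ.+ D)))
                          (S².·s-mono-< lower))))
      where
      re-form : ∀ a c d s → (a ℚ.* s) ℚ.+ (ℚ.- (ℚ.- (d ℚ.* s))) ≡ (a ℚ.+ d) ℚ.* s
      re-form = solve-∀ ℚ-ring
      im-form : ∀ a c d s → (ℚ.- (c ℚ.* s)) ℚ.+ (ℚ.- (ℚ.- 0ℚ)) ≡ ℚ.- (c ℚ.* s)
      im-form = solve-∀ ℚ-ring
    im-below : ∀ a c d s → 0ℚ ℚ.+ (ℚ.- (ℚ.- (c ℚ.* s))) ≡ c ℚ.* s
    im-below = solve-∀ ℚ-ring
    below : Positive (fromℚ (D ·s) ⊖ ((A ·s) + (ℚ.- (C ·s)) √3))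
    below with D ℕ.<? A
    ... | yes D<A = subst Positive (sym (ℚ√3-≡ re-eq (im-below (ℕ→ℚ A) (ℕ→ℚ C) (ℕ→ℚ D) s)))
      (inj₂ (inj₂ (ℚP.neg-antimono-< (·s-pos (A ℕ.∸ D) (ℕP.m<n⇒0<n∸m D<A)) , C·s>0 ,
                   subst₂ ℚ._<_ (sym (trans (neg-square ((A ℕ.∸ D) ·s)) (·s-square (A ℕ.∸ D)))) (sym 3C²)
                          (S².·s-mono-< (upper D<A)))))
      where
      re-eq : re (fromℚ (D ·s) ⊖ ((A ·s) + (ℚ.- (C ·s)) √3)) ≡ ℚ.- ((A ℕ.∸ D) ·s)
      re-eq = trans (cong (λ a → D ·s ℚ.+ ℚ.- (a ℚ.* s))
                          (trans (cong ℕ→ℚ (sym (ℕP.m∸n+n≡m (ℕP.<⇒≤ D<A)))) (ℕ→ℚ-+ (A ℕ.∸ D) D)))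
                    (re-form (ℕ→ℚ (A ℕ.∸ D)) (ℕ→ℚ D) s)
        where
        re-form : ∀ x d s → d ℚ.* s ℚ.+ ℚ.- ((x ℚ.+ d) ℚ.* s) ≡ ℚ.- (x ℚ.* s)
        re-form = solve-∀ ℚ-ring
    ... | no D≮A = subst Positive (sym (ℚ√3-≡ re-eq (im-below (ℕ→ℚ A) (ℕ→ℚ C) (ℕ→ℚ D) s)))
      (inj₁ (·s-nonneg (D ℕ.∸ A) , ℚP.<⇒≤ C·s>0 , inj₂ C·s>0))
      where
      re-eq : re (fromℚ (D ·s) ⊖ ((A ·s) + (ℚ.- (C ·s)) √3)) ≡ (D ℕ.∸ A) ·s
      re-eq = trans (cong (λ d → d ℚ.* s ℚ.+ ℚ.- (A ·s))
                          (trans (cong ℕ→ℚ (sym (ℕP.m∸n+n≡m (ℕP.≮⇒≥ D≮A)))) (ℕ→ℚ-+ (D ℕ.∸ A) A)))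
                    (re-form (ℕ→ℚ (D ℕ.∸ A)) (ℕ→ℚ A) s)
        where
        re-form : ∀ x a s → (x ℚ.+ a) ℚ.* s ℚ.+ ℚ.- (a ℚ.* s) ≡ x ℚ.* s
        re-form = solve-∀ ℚ-ring

  1div-pos : (k : ℕ) → 1 ℕ.≤ k → 0ℚ ℚ.< 1ℚ div ℕ→ℚ k
  1div-pos k k≥1 = ℚP.*-cancelˡ-<-nonNeg (ℕ→ℚ k) {{ℚ.nonNegative (ℕ→ℚ-mono-≤ {0} {k} z≤n)}}
    (subst₂ ℚ._<_ (sym (ℚP.*-zeroʳ (ℕ→ℚ k))) (sym (*-1div (ℕ→ℚ k) (ℕ→ℚ-≢0 k k≥1))) (ℕ→ℚ-mono-< {0} {1} (s≤s z≤n)))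

module NormBounds where

  open ClosedForms using (powRe; powIm; meanNumer)
  open import Data.Nat as ℕ using (ℕ; zero; suc; _+_; _*_; _∸_; _≤_; _<_; z≤n; s≤s)
  open import Data.Nat.Properties
  open import Data.Sum using (_⊎_; inj₁; inj₂)
  open import Data.Product using (_×_; _,_)
  open import Relation.Binary.PropositionalEquality
  open import Data.Nat.Tactic.RingSolver using (solve-∀)

  -- the norm of (1 + √3)ⁿ is (−2)ⁿ
  powRe²-3powIm² : (n : ℕ) → (powRe n * powRe n ≡ 3 * (powIm n * powIm n) + 2 ℕ.^ n)
                            ⊎ (3 * (powIm n * powIm n) ≡ powRe n * powRe n + 2 ℕ.^ n)
  powRe²-3powIm² zero = inj₁ refl
  powRe²-3powIm² (suc n) with powRe²-3powIm² n
  ... | inj₁ p²≡3q²+t = inj₂ (+-cancelʳ-≡ (6 * (q * q)) _ _ (begin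
      3 * ((p + q) * (p + q)) + 6 * (q * q)
    ≡⟨ step p q ⟨
      (p + 3 * q) * (p + 3 * q) + 2 * (p * p)
    ≡⟨ cong (λ x → (p + 3 * q) * (p + 3 * q) + 2 * x) p²≡3q²+t ⟩
      (p + 3 * q) * (p + 3 * q) + 2 * (3 * (q * q) + t)
    ≡⟨ regroup (p + 3 * q) q t ⟩
      (p + 3 * q) * (p + 3 * q) + 2 * t + 6 * (q * q)
    ∎))
    where
    open ≡-Reasoning
    p = powRe n
    q = powIm n
    t = 2 ℕ.^ n
    regroup : ∀ x q t → x * x + 2 * (3 * (q * q) + t) ≡ x * x + 2 * t + 6 * (q * q)
    regroup = solve-∀
    step : ∀ p q → (p + 3 * q) * (p + 3 * q) + 2 * (p * p) ≡ 3 * ((p + q) * (p + q)) + 6 * (q * q)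
    step = solve-∀
  ... | inj₂ 3q²≡p²+t = inj₁ (+-cancelʳ-≡ (2 * (p * p)) _ _ (begin
      (p + 3 * q) * (p + 3 * q) + 2 * (p * p)
    ≡⟨ step p q ⟩
      3 * ((p + q) * (p + q)) + 6 * (q * q)
    ≡⟨ cong (3 * ((p + q) * (p + q)) +_) (*-assoc 2 3 (q * q)) ⟩
      3 * ((p + q) * (p + q)) + 2 * (3 * (q * q))
    ≡⟨ cong (λ x → 3 * ((p + q) * (p + q)) + 2 * x) 3q²≡p²+t ⟩
      3 * ((p + q) * (p + q)) + 2 * (p * p + t)
    ≡⟨ regroup (p + q) p t ⟩
      3 * ((p + q) * (p + q)) + 2 * t + 2 * (p * p)
    ∎))
    where
    open ≡-Reasoning
    p = powRe n
    q = powIm n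
    t = 2 ℕ.^ n
    regroup : ∀ y p t → 3 * (y * y) + 2 * (p * p + t) ≡ 3 * (y * y) + 2 * t + 2 * (p * p)
    regroup = solve-∀
    step : ∀ p q → (p + 3 * q) * (p + 3 * q) + 2 * (p * p) ≡ 3 * ((p + q) * (p + q)) + 6 * (q * q)
    step = solve-∀

  2ⁿ≤powRe+powIm : (n : ℕ) → 2 ℕ.^ n ≤ powRe n + powIm n
  2ⁿ≤powRe+powIm zero    = ≤-refl
  2ⁿ≤powRe+powIm (suc n) = ≤-trans (*-monoʳ-≤ 2 (2ⁿ≤powRe+powIm n))
    (≤-trans (m≤m+n (2 * (powRe n + powIm n)) (2 * powIm n)) (≤-reflexive (regroup (powRe n) (powIm n))))
    where
    regroup : ∀ p q → 2 * (p + q) + 2 * q ≡ (p + 3 * q) + (p + q)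
    regroup = solve-∀

  -- (aK ± d)² = (aK)² ± 2adK + d², while |(aK)² − 3(bK)²| ≤ GK² ≤ adK
  scaled-gap : (a b d K G : ℕ) → 3 * (b * b) ≤ a * a + G → a * a ≤ 3 * (b * b) + G → G * K ≤ a * d → 1 ≤ d →
    (3 * (b * K * (b * K)) < (a * K + d) * (a * K + d))
    × (d < a * K → (a * K ∸ d) * (a * K ∸ d) < 3 * (b * K * (b * K)))
  scaled-gap a b d K G 3b²≤ a²≤ GK≤ad d≥1 = lower , upper
    where
    square-out : ∀ b K → 3 * (b * K * (b * K)) ≡ 3 * (b * b) * (K * K)
    square-out = solve-∀
    square-out′ : ∀ a K → a * K * (a * K) ≡ a * a * (K * K)
    square-out′ = solve-∀
    distribute : ∀ a G K → (a * a + G) * (K * K) ≡ a * K * (a * K) + G * K * K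
    distribute = solve-∀
    distribute′ : ∀ b G K → (3 * (b * b) + G) * (K * K) ≡ 3 * (b * K * (b * K)) + G * K * K
    distribute′ = solve-∀
    square-expand : ∀ a d K → a * K * (a * K) + (a * d * K + (a * d * K + d * d)) ≡ (a * K + d) * (a * K + d)
    square-expand = solve-∀
    square-expand′ : ∀ x d → x * x + x * d + (x * d + d * d) ≡ (x + d) * (x + d)
    square-expand′ = solve-∀
    regroup : ∀ a d K → a * d * K ≡ a * K * d
    regroup = solve-∀
    lower : 3 * (b * K * (b * K)) < (a * K + d) * (a * K + d)
    lower = begin-strict
        3 * (b * K * (b * K))
      ≡⟨ square-out b K ⟩
        3 * (b * b) * (K * K)
      ≤⟨ *-monoˡ-≤ (K * K) 3b²≤ ⟩
        (a * a + G) * (K * K)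
      ≡⟨ distribute a G K ⟩
        a * K * (a * K) + G * K * K
      ≤⟨ +-monoʳ-≤ (a * K * (a * K)) (*-monoˡ-≤ K GK≤ad) ⟩
        a * K * (a * K) + a * d * K
      <⟨ +-monoʳ-< (a * K * (a * K)) (m<m+n (a * d * K) (≤-trans (*-mono-≤ d≥1 d≥1) (m≤n+m (d * d) (a * d * K)))) ⟩
        a * K * (a * K) + (a * d * K + (a * d * K + d * d))
      ≡⟨ square-expand a d K ⟩
        (a * K + d) * (a * K + d)
      ∎
      where open ≤-Reasoning
    upper : d < a * K → (a * K ∸ d) * (a * K ∸ d) < 3 * (b * K * (b * K))
    upper d<aK = <-≤-trans (m<m+n (x * x) (*-mono-≤ (m<n⇒0<n∸m d<aK) d≥1)) (+-cancelʳ-≤ (x * d + d * d) _ _ (begin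
        x * x + x * d + (x * d + d * d)
      ≡⟨ square-expand′ x d ⟩
        (x + d) * (x + d)
      ≡⟨ cong (λ y → y * y) x+d≡aK ⟩
        a * K * (a * K)
      ≡⟨ square-out′ a K ⟩
        a * a * (K * K)
      ≤⟨ *-monoˡ-≤ (K * K) a²≤ ⟩
        (3 * (b * b) + G) * (K * K)
      ≡⟨ distribute′ b G K ⟩
        3 * (b * K * (b * K)) + G * K * K
      ≤⟨ +-monoʳ-≤ (3 * (b * K * (b * K))) (*-monoˡ-≤ K GK≤ad) ⟩
        3 * (b * K * (b * K)) + a * d * K
      ≡⟨ cong (3 * (b * K * (b * K)) +_) (trans (regroup a d K) (cong (_* d) (sym x+d≡aK))) ⟩
        3 * (b * K * (b * K)) + (x + d) * d
      ≡⟨ cong (3 * (b * K * (b * K)) +_) (*-distribʳ-+ d x d) ⟩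
        3 * (b * K * (b * K)) + (x * d + d * d)
      ∎))
      where
      open ≤-Reasoning
      x = a * K ∸ d
      x+d≡aK : x + d ≡ a * K
      x+d≡aK = m∸n+n≡m (<⇒≤ d<aK)

  n<2ⁿ : (n : ℕ) → n < 2 ℕ.^ n
  n<2ⁿ zero    = s≤s z≤n
  n<2ⁿ (suc n) = ≤-trans (+-mono-≤ (m^n>0 2 n) (n<2ⁿ n)) (≤-reflexive (sym (cong (2 ℕ.^ n +_) (+-identityʳ (2 ℕ.^ n)))))

  -- 18 · norm (asymp (3 + m)) = 3n² − 6n − 1 for n = 3 + m
  normFactor : ℕ → ℕ
  normFactor m = 3 * m * m + 12 * m + 8

  -- (ratioRe n − ratioIm n · √3) / ratioDen m is E/asymp − 1 at n = 3 + m
  ratioRe ratioIm : ℕ → ℕ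
  ratioRe n = (n + 1) * ((3 * n + 1) * powRe n + 6 * n * powIm n)
  ratioIm n = (n + 1) * meanNumer n

  ratioDen : ℕ → ℕ
  ratioDen m = normFactor m * (powRe (3 + m) + powIm (3 + m))

  ratioGap : ℕ → ℕ
  ratioGap m = (3 + m + 1) * (3 + m + 1) * normFactor m * 2 ℕ.^ (3 + m)

  norm-identity : ∀ m p q → let n = 3 + m ; c = (n + 1) * (n + 1) * (3 * m * m + 12 * m + 8) in
    (n + 1) * ((3 * n + 1) * p + 6 * n * q) * ((n + 1) * ((3 * n + 1) * p + 6 * n * q)) + c * (p * p)
      ≡ 3 * ((n + 1) * (2 * n * p + (3 * n + 1) * q) * ((n + 1) * (2 * n * p + (3 * n + 1) * q))) + c * (3 * (q * q))
  norm-identity = solve-∀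

  ratio-norm-bounds : (m : ℕ) → let n = 3 + m in
    (3 * (ratioIm n * ratioIm n) ≤ ratioRe n * ratioRe n + ratioGap m)
    × (ratioRe n * ratioRe n ≤ 3 * (ratioIm n * ratioIm n) + ratioGap m)
  ratio-norm-bounds m with powRe²-3powIm² (3 + m)
  ... | inj₁ p²≡3q²+t = ≤-reflexive (sym re²+gap≡3im²) , ≤-trans (m≤m+n _ (ratioGap m)) (≤-trans (≤-reflexive re²+gap≡3im²) (m≤m+n _ _))
    where
    re²+gap≡3im² : ratioRe (3 + m) * ratioRe (3 + m) + ratioGap m ≡ 3 * (ratioIm (3 + m) * ratioIm (3 + m))
    re²+gap≡3im² = +-cancelʳ-≡ (c * (3 * (q * q))) _ _ (begin
        α² + c * t + c * (3 * (q * q))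
      ≡⟨ regroup α² c t (3 * (q * q)) ⟩
        α² + c * (3 * (q * q) + t)
      ≡⟨ cong (λ y → α² + c * y) p²≡3q²+t ⟨
        α² + c * (p * p)
      ≡⟨ norm-identity m p q ⟩
        3 * (ratioIm (3 + m) * ratioIm (3 + m)) + c * (3 * (q * q))
      ∎)
      where
      open ≡-Reasoning
      p = powRe (3 + m)
      q = powIm (3 + m)
      t = 2 ℕ.^ (3 + m)
      c = (3 + m + 1) * (3 + m + 1) * normFactor m
      α² = ratioRe (3 + m) * ratioRe (3 + m)
      regroup : ∀ a c t u → a + c * t + c * u ≡ a + c * (u + t)
      regroup = solve-∀
  ... | inj₂ 3q²≡p²+t = ≤-trans (m≤m+n _ (ratioGap m)) (≤-trans (≤-reflexive (sym re²≡3im²+gap)) (m≤m+n _ _)) , ≤-reflexive re²≡3im²+gap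
    where
    re²≡3im²+gap : ratioRe (3 + m) * ratioRe (3 + m) ≡ 3 * (ratioIm (3 + m) * ratioIm (3 + m)) + ratioGap m
    re²≡3im²+gap = +-cancelʳ-≡ (c * (p * p)) _ _ (begin
        ratioRe (3 + m) * ratioRe (3 + m) + c * (p * p)
      ≡⟨ norm-identity m p q ⟩
        3β² + c * (3 * (q * q))
      ≡⟨ cong (λ y → 3β² + c * y) 3q²≡p²+t ⟩
        3β² + c * (p * p + t)
      ≡⟨ regroup 3β² c (p * p) t ⟩
        3β² + c * t + c * (p * p)
      ∎)
      where
      open ≡-Reasoning
      p = powRe (3 + m)
      q = powIm (3 + m)
      t = 2 ℕ.^ (3 + m)
      c = (3 + m + 1) * (3 + m + 1) * normFactor m
      3β² = 3 * (ratioIm (3 + m) * ratioIm (3 + m))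
      regroup : ∀ a c u t → a + c * (u + t) ≡ a + c * t + c * u
      regroup = solve-∀

  ratioGap-small : (m w u : ℕ) → w ≤ 2 ℕ.^ (3 + m) → 1 ≤ u →
    ratioGap m * w ≤ ratioRe (3 + m) * (u * ratioDen m)
  ratioGap-small m w u w≤2ⁿ u≥1 = begin
      ratioGap m * w
    ≡⟨ regroup (n + 1) (normFactor m) (2 ℕ.^ n) w ⟩
      (n + 1) * normFactor m * ((n + 1) * 2 ℕ.^ n) * w
    ≤⟨ *-mono-≤ (*-monoʳ-≤ ((n + 1) * normFactor m) (≤-trans (*-monoʳ-≤ (n + 1) (2ⁿ≤powRe+powIm n)) X≥[n+1][p+q]))
                (≤-trans w≤2ⁿ (2ⁿ≤powRe+powIm n)) ⟩
      (n + 1) * normFactor m * X * (p + q)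
    ≡⟨ regroup′ (n + 1) (normFactor m) X (p + q) ⟩
      ratioRe n * ratioDen m
    ≤⟨ *-monoʳ-≤ (ratioRe n) (m≤n*m (ratioDen m) u {{ℕ.>-nonZero u≥1}}) ⟩
      ratioRe n * (u * ratioDen m)
    ∎
    where
    open ≤-Reasoning
    n = 3 + m
    p = powRe n
    q = powIm n
    X = (3 * n + 1) * p + 6 * n * q
    X≥[n+1][p+q] : (n + 1) * (p + q) ≤ X
    X≥[n+1][p+q] = ≤-trans (m≤m+n ((n + 1) * (p + q)) (2 * n * p + (5 * m + 14) * q)) (≤-reflexive (split m p q))
      where
      split : ∀ m p q → (3 + m + 1) * (p + q) + (2 * (3 + m) * p + (5 * m + 14) * q)
                        ≡ (3 * (3 + m) + 1) * p + 6 * (3 + m) * q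
      split = solve-∀
    regroup : ∀ k M t w → k * k * M * t * w ≡ k * M * (k * t) * w
    regroup = solve-∀
    regroup′ : ∀ k M X y → k * M * X * y ≡ k * X * (M * y)
    regroup′ = solve-∀

module Asymptotics where

  open QuadraticField
  open import Tactic.RingSolver using (solve-∀)
  open Order
  open ClosedForms
  open ExactFormula
  open NormBounds
  open import Data.Nat as ℕ using (ℕ; zero; suc; z≤n; s≤s)
  import Data.Nat.Properties as ℕP
  open import Data.Integer as ℤ using (+_; +[1+_]; -[1+_])
  import Data.Integer.Properties as ℤP
  open import Data.Rational as ℚ using (ℚ; mkℚ; 0ℚ; 1ℚ; _/_; *<*)
  import Data.Rational.Properties as ℚP
  open import Data.Rational.Unnormalised as ℚᵘ using (*≡*)
  import Data.Rational.Unnormalised.Properties as ℚᵘP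
  import Data.Nat.Coprimality as Coprimality
  open import Data.Product using (_,_; proj₁; proj₂)
  open import Relation.Binary.PropositionalEquality
  open import Relation.Nullary using (¬_)

  asymp≡ : (n : ℕ) → asymp n ≡ ((ℕ→ℚ 3 ℚ.* ℕ→ℚ n ℚ.- 1ℚ) ℚ.* (+ 1 / 6)) + ((ℕ→ℚ n ℚ.+ 1ℚ) ℚ.* (+ 1 / 6)) √3
  asymp≡ n = ⊘-unique _ _ _ (λ ()) (ℚ√3-≡ (re-form (ℕ→ℚ n)) (im-form (ℕ→ℚ n)))
    where
    re-form : ∀ x →
      ((ℕ→ℚ 3 ℚ.* x ℚ.- 1ℚ) ℚ.* (+ 1 / 6)) ℚ.* ((ℕ→ℚ 3) ℚ.* ((ℕ→ℚ 3) ℚ.+ 0ℚ) ℚ.+ ℕ→ℚ 3 ℚ.* (0ℚ ℚ.* (0ℚ ℚ.+ 1ℚ))) ℚ.+ ℕ→ℚ 3 ℚ.* (((x ℚ.+ 1ℚ) ℚ.* (+ 1 / 6)) ℚ.* ((ℕ→ℚ 3) ℚ.* (0ℚ ℚ.+ 1ℚ) ℚ.+ 0ℚ ℚ.* ((ℕ→ℚ 3) ℚ.+ 0ℚ)))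
        ≡ (((ℕ→ℚ 3) ℚ.* ((ℕ→ℚ 2) ℚ.+ 0ℚ) ℚ.+ ℕ→ℚ 3 ℚ.* (0ℚ ℚ.* (0ℚ ℚ.+ 1ℚ))) ℚ.* x ℚ.+ ℕ→ℚ 3 ℚ.* (((ℕ→ℚ 3) ℚ.* (0ℚ ℚ.+ 1ℚ) ℚ.+ 0ℚ ℚ.* ((ℕ→ℚ 2) ℚ.+ 0ℚ)) ℚ.* 0ℚ)) ℚ.+ 0ℚ
    re-form = solve-∀ ℚ-ring
    im-form : ∀ x →
      ((ℕ→ℚ 3 ℚ.* x ℚ.- 1ℚ) ℚ.* (+ 1 / 6)) ℚ.* ((ℕ→ℚ 3) ℚ.* (0ℚ ℚ.+ 1ℚ) ℚ.+ 0ℚ ℚ.* ((ℕ→ℚ 3) ℚ.+ 0ℚ)) ℚ.+ ((x ℚ.+ 1ℚ) ℚ.* (+ 1 / 6)) ℚ.* ((ℕ→ℚ 3) ℚ.* ((ℕ→ℚ 3) ℚ.+ 0ℚ) ℚ.+ ℕ→ℚ 3 ℚ.* (0ℚ ℚ.* (0ℚ ℚ.+ 1ℚ)))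
        ≡ (((ℕ→ℚ 3) ℚ.* ((ℕ→ℚ 2) ℚ.+ 0ℚ) ℚ.+ ℕ→ℚ 3 ℚ.* (0ℚ ℚ.* (0ℚ ℚ.+ 1ℚ))) ℚ.* 0ℚ ℚ.+ ((ℕ→ℚ 3) ℚ.* (0ℚ ℚ.+ 1ℚ) ℚ.+ 0ℚ ℚ.* ((ℕ→ℚ 2) ℚ.+ 0ℚ)) ℚ.* x) ℚ.+ 1ℚ
    im-form = solve-∀ ℚ-ring

  ratio-1≡ : (e c d : ℚ) → (fromℚ e ⊘ (c + d √3)) ⊖ one ≡
    (e ℚ.* c ℚ.* (1ℚ div norm (c + d √3)) ℚ.- 1ℚ) + (ℚ.- (e ℚ.* d ℚ.* (1ℚ div norm (c + d √3)))) √3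
  ratio-1≡ e c d = trans (cong (λ y → (fromℚ e ⊗ y) ⊖ one) (inv≡ c d))
    (ℚ√3-≡ (re-form e c d (1ℚ div norm (c + d √3))) (im-form e c d (1ℚ div norm (c + d √3))))
    where
    re-form : ∀ e c d r → (e ℚ.* (c ℚ.* r) ℚ.+ ℕ→ℚ 3 ℚ.* (0ℚ ℚ.* ((ℚ.- d) ℚ.* r))) ℚ.+ (ℚ.- 1ℚ) ≡ e ℚ.* c ℚ.* r ℚ.- 1ℚ
    re-form = solve-∀ ℚ-ring
    im-form : ∀ e c d r → (e ℚ.* ((ℚ.- d) ℚ.* r) ℚ.+ 0ℚ ℚ.* (c ℚ.* r)) ℚ.+ (ℚ.- 0ℚ) ≡ ℚ.- (e ℚ.* d ℚ.* r)
    im-form = solve-∀ ℚ-ring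

  ratio : ℕ → ℚ√3
  ratio n = (fromℚ (expectedLucky n) ⊘ asymp n) ⊖ one

  module AtLeastThree (m : ℕ) where

    n = 3 ℕ.+ m
    x = ℕ→ℚ n
    P = ℕ→ℚ (powRe n)
    Q = ℕ→ℚ (powIm n)
    E = expectedLucky n
    ρ = (ℕ→ℚ 3 ℚ.* x ℚ.- 1ℚ) ℚ.* (+ 1 / 6)
    σ = (x ℚ.+ 1ℚ) ℚ.* (+ 1 / 6)
    N = norm (ρ + σ √3)
    R = 1ℚ div N

    ratio≡ : ratio n ≡ (E ℚ.* ρ ℚ.* R ℚ.- 1ℚ) + (ℚ.- (E ℚ.* σ ℚ.* R)) √3
    ratio≡ = trans (cong (λ y → (fromℚ E ⊘ y) ⊖ one) (asymp≡ n)) (ratio-1≡ E ρ σ)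

    normFactor≡18N : ℕ→ℚ (normFactor m) ≡ ℕ→ℚ 18 ℚ.* N
    normFactor≡18N = begin
        ℕ→ℚ (3 ℕ.* m ℕ.* m ℕ.+ 12 ℕ.* m ℕ.+ 8)
      ≡⟨ trans (ℕ→ℚ-+ (3 ℕ.* m ℕ.* m ℕ.+ 12 ℕ.* m) 8)
               (cong (ℚ._+ ℕ→ℚ 8) (trans (ℕ→ℚ-+ (3 ℕ.* m ℕ.* m) (12 ℕ.* m))
                 (cong₂ ℚ._+_ (trans (ℕ→ℚ-* (3 ℕ.* m) m) (cong (ℚ._* ℕ→ℚ m) (ℕ→ℚ-* 3 m))) (ℕ→ℚ-* 12 m)))) ⟩
        ℕ→ℚ 3 ℚ.* ℕ→ℚ m ℚ.* ℕ→ℚ m ℚ.+ ℕ→ℚ 12 ℚ.* ℕ→ℚ m ℚ.+ ℕ→ℚ 8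
      ≡⟨ in-terms-of-n (ℕ→ℚ m) ⟩
        ℕ→ℚ 18 ℚ.* norm ((((ℕ→ℚ 3 ℚ.* (ℕ→ℚ 3 ℚ.+ ℕ→ℚ m)) ℚ.- 1ℚ) ℚ.* (+ 1 / 6))
                          + (((ℕ→ℚ 3 ℚ.+ ℕ→ℚ m) ℚ.+ 1ℚ) ℚ.* (+ 1 / 6)) √3)
      ≡⟨ cong (λ y → ℕ→ℚ 18 ℚ.* norm ((((ℕ→ℚ 3 ℚ.* y) ℚ.- 1ℚ) ℚ.* (+ 1 / 6)) + ((y ℚ.+ 1ℚ) ℚ.* (+ 1 / 6)) √3))
              (ℕ→ℚ-+ 3 m) ⟨
        ℕ→ℚ 18 ℚ.* N
      ∎
      where
      open ≡-Reasoning
      in-terms-of-n : ∀ k → ℕ→ℚ 3 ℚ.* k ℚ.* k ℚ.+ ℕ→ℚ 12 ℚ.* k ℚ.+ ℕ→ℚ 8 ≡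
        ℕ→ℚ 18 ℚ.* (((ℕ→ℚ 3 ℚ.* (ℕ→ℚ 3 ℚ.+ k) ℚ.- 1ℚ) ℚ.* (+ 1 / 6)) ℚ.* ((ℕ→ℚ 3 ℚ.* (ℕ→ℚ 3 ℚ.+ k) ℚ.- 1ℚ) ℚ.* (+ 1 / 6)) ℚ.- ℕ→ℚ 3 ℚ.* (((ℕ→ℚ 3 ℚ.+ k ℚ.+ 1ℚ) ℚ.* (+ 1 / 6)) ℚ.* ((ℕ→ℚ 3 ℚ.+ k ℚ.+ 1ℚ) ℚ.* (+ 1 / 6))))
      in-terms-of-n = solve-∀ ℚ-ring

    N≢0 : ¬ N ≡ 0ℚ
    N≢0 N≡0 = ℕ→ℚ-≢0 (normFactor m) (ℕP.≤-trans (s≤s z≤n) (ℕP.m≤n+m 8 _))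
      (trans normFactor≡18N (trans (cong (ℕ→ℚ 18 ℚ.*_) N≡0) (ℚP.*-zeroʳ (ℕ→ℚ 18))))

    E-fact : E ℚ.* (ℕ→ℚ 3 ℚ.* (P ℚ.+ Q)) ≡ ℕ→ℚ 2 ℚ.* x ℚ.* P ℚ.+ (ℕ→ℚ 3 ℚ.* x ℚ.+ 1ℚ) ℚ.* Q
    E-fact = trans (cong (E ℚ.*_) (sym (ℕ→ℚ-meanDenom n))) (trans (expectedLucky-*-meanDenom n) (ℕ→ℚ-meanNumer n))

    ratioDen≡ : ℕ→ℚ (ratioDen m) ≡ ℕ→ℚ 18 ℚ.* N ℚ.* (P ℚ.+ Q)
    ratioDen≡ = trans (ℕ→ℚ-* (normFactor m) (powRe n ℕ.+ powIm n))
                      (cong₂ ℚ._*_ normFactor≡18N (ℕ→ℚ-+ (powRe n) (powIm n)))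

    ratioRe≡ : ℕ→ℚ (ratioRe n) ≡ (x ℚ.+ 1ℚ) ℚ.* ((ℕ→ℚ 3 ℚ.* x ℚ.+ 1ℚ) ℚ.* P ℚ.+ ℕ→ℚ 6 ℚ.* x ℚ.* Q)
    ratioRe≡ = trans (ℕ→ℚ-* (n ℕ.+ 1) ((3 ℕ.* n ℕ.+ 1) ℕ.* powRe n ℕ.+ 6 ℕ.* n ℕ.* powIm n))
      (cong₂ ℚ._*_ (ℕ→ℚ-+ n 1)
        (trans (ℕ→ℚ-+ ((3 ℕ.* n ℕ.+ 1) ℕ.* powRe n) (6 ℕ.* n ℕ.* powIm n))
          (cong₂ ℚ._+_ (trans (ℕ→ℚ-* (3 ℕ.* n ℕ.+ 1) (powRe n)) (cong (ℚ._* P) (ℕ→ℚ-3n+1 n)))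
                       (trans (ℕ→ℚ-* (6 ℕ.* n) (powIm n)) (cong (ℚ._* Q) (ℕ→ℚ-* 6 n))))))

    ratioIm≡ : ℕ→ℚ (ratioIm n) ≡ (x ℚ.+ 1ℚ) ℚ.* (ℕ→ℚ 2 ℚ.* x ℚ.* P ℚ.+ (ℕ→ℚ 3 ℚ.* x ℚ.+ 1ℚ) ℚ.* Q)
    ratioIm≡ = trans (ℕ→ℚ-* (n ℕ.+ 1) (meanNumer n)) (cong₂ ℚ._*_ (ℕ→ℚ-+ n 1) (ℕ→ℚ-meanNumer n))

    re-ratio-scaled : re (ratio n) ℚ.* ℕ→ℚ (ratioDen m) ≡ ℕ→ℚ (ratioRe n)
    re-ratio-scaled = begin
        re (ratio n) ℚ.* ℕ→ℚ (ratioDen m)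
      ≡⟨ cong₂ ℚ._*_ (cong re ratio≡) ratioDen≡ ⟩
        (E ℚ.* ρ ℚ.* R ℚ.- 1ℚ) ℚ.* (ℕ→ℚ 18 ℚ.* N ℚ.* (P ℚ.+ Q))
      ≡⟨ factor E ρ N R P Q ⟩
        ℕ→ℚ 6 ℚ.* ρ ℚ.* (N ℚ.* R) ℚ.* (E ℚ.* (ℕ→ℚ 3 ℚ.* (P ℚ.+ Q))) ℚ.- ℕ→ℚ 18 ℚ.* N ℚ.* (P ℚ.+ Q)
      ≡⟨ cong₂ (λ t e → ℕ→ℚ 6 ℚ.* ρ ℚ.* t ℚ.* e ℚ.- ℕ→ℚ 18 ℚ.* N ℚ.* (P ℚ.+ Q)) (*-1div N N≢0) E-fact ⟩
        ℕ→ℚ 6 ℚ.* ρ ℚ.* 1ℚ ℚ.* (ℕ→ℚ 2 ℚ.* x ℚ.* P ℚ.+ (ℕ→ℚ 3 ℚ.* x ℚ.+ 1ℚ) ℚ.* Q) ℚ.- ℕ→ℚ 18 ℚ.* N ℚ.* (P ℚ.+ Q)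
      ≡⟨ expand x P Q ⟩
        (x ℚ.+ 1ℚ) ℚ.* ((ℕ→ℚ 3 ℚ.* x ℚ.+ 1ℚ) ℚ.* P ℚ.+ ℕ→ℚ 6 ℚ.* x ℚ.* Q)
      ≡⟨ ratioRe≡ ⟨
        ℕ→ℚ (ratioRe n)
      ∎
      where
      open ≡-Reasoning
      factor : ∀ E ρ N R P Q → (E ℚ.* ρ ℚ.* R ℚ.- 1ℚ) ℚ.* (ℕ→ℚ 18 ℚ.* N ℚ.* (P ℚ.+ Q))
        ≡ ℕ→ℚ 6 ℚ.* ρ ℚ.* (N ℚ.* R) ℚ.* (E ℚ.* (ℕ→ℚ 3 ℚ.* (P ℚ.+ Q))) ℚ.- ℕ→ℚ 18 ℚ.* N ℚ.* (P ℚ.+ Q)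
      factor = solve-∀ ℚ-ring
      expand : ∀ x P Q →
        ℕ→ℚ 6 ℚ.* ((ℕ→ℚ 3 ℚ.* x ℚ.- 1ℚ) ℚ.* (+ 1 / 6)) ℚ.* 1ℚ ℚ.* (ℕ→ℚ 2 ℚ.* x ℚ.* P ℚ.+ (ℕ→ℚ 3 ℚ.* x ℚ.+ 1ℚ) ℚ.* Q)
          ℚ.- ℕ→ℚ 18 ℚ.* (((ℕ→ℚ 3 ℚ.* x ℚ.- 1ℚ) ℚ.* (+ 1 / 6)) ℚ.* ((ℕ→ℚ 3 ℚ.* x ℚ.- 1ℚ) ℚ.* (+ 1 / 6)) ℚ.- ℕ→ℚ 3 ℚ.* (((x ℚ.+ 1ℚ) ℚ.* (+ 1 / 6)) ℚ.* ((x ℚ.+ 1ℚ) ℚ.* (+ 1 / 6)))) ℚ.* (P ℚ.+ Q)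
        ≡ (x ℚ.+ 1ℚ) ℚ.* ((ℕ→ℚ 3 ℚ.* x ℚ.+ 1ℚ) ℚ.* P ℚ.+ ℕ→ℚ 6 ℚ.* x ℚ.* Q)
      expand = solve-∀ ℚ-ring

    im-ratio-scaled : ℚ.- im (ratio n) ℚ.* ℕ→ℚ (ratioDen m) ≡ ℕ→ℚ (ratioIm n)
    im-ratio-scaled = begin
        ℚ.- im (ratio n) ℚ.* ℕ→ℚ (ratioDen m)
      ≡⟨ cong₂ (λ i d → ℚ.- i ℚ.* d) (cong im ratio≡) ratioDen≡ ⟩
        ℚ.- (ℚ.- (E ℚ.* σ ℚ.* R)) ℚ.* (ℕ→ℚ 18 ℚ.* N ℚ.* (P ℚ.+ Q))
      ≡⟨ factor E σ N R P Q ⟩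
        ℕ→ℚ 6 ℚ.* σ ℚ.* (N ℚ.* R) ℚ.* (E ℚ.* (ℕ→ℚ 3 ℚ.* (P ℚ.+ Q)))
      ≡⟨ cong₂ (λ t e → ℕ→ℚ 6 ℚ.* σ ℚ.* t ℚ.* e) (*-1div N N≢0) E-fact ⟩
        ℕ→ℚ 6 ℚ.* σ ℚ.* 1ℚ ℚ.* (ℕ→ℚ 2 ℚ.* x ℚ.* P ℚ.+ (ℕ→ℚ 3 ℚ.* x ℚ.+ 1ℚ) ℚ.* Q)
      ≡⟨ expand x P Q ⟩
        (x ℚ.+ 1ℚ) ℚ.* (ℕ→ℚ 2 ℚ.* x ℚ.* P ℚ.+ (ℕ→ℚ 3 ℚ.* x ℚ.+ 1ℚ) ℚ.* Q)
      ≡⟨ ratioIm≡ ⟨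
        ℕ→ℚ (ratioIm n)
      ∎
      where
      open ≡-Reasoning
      factor : ∀ E σ N R P Q → ℚ.- (ℚ.- (E ℚ.* σ ℚ.* R)) ℚ.* (ℕ→ℚ 18 ℚ.* N ℚ.* (P ℚ.+ Q))
        ≡ ℕ→ℚ 6 ℚ.* σ ℚ.* (N ℚ.* R) ℚ.* (E ℚ.* (ℕ→ℚ 3 ℚ.* (P ℚ.+ Q)))
      factor = solve-∀ ℚ-ring
      expand : ∀ x P Q →
        ℕ→ℚ 6 ℚ.* ((x ℚ.+ 1ℚ) ℚ.* (+ 1 / 6)) ℚ.* 1ℚ ℚ.* (ℕ→ℚ 2 ℚ.* x ℚ.* P ℚ.+ (ℕ→ℚ 3 ℚ.* x ℚ.+ 1ℚ) ℚ.* Q)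
        ≡ (x ℚ.+ 1ℚ) ℚ.* (ℕ→ℚ 2 ℚ.* x ℚ.* P ℚ.+ (ℕ→ℚ 3 ℚ.* x ℚ.+ 1ℚ) ℚ.* Q)
      expand = solve-∀ ℚ-ring

  *-denominator : (e d : ℕ) .(c : Coprimality.Coprime (suc e) (suc d)) →
    mkℚ +[1+ e ] d c ℚ.* ℕ→ℚ (suc d) ≡ ℕ→ℚ (suc e)
  *-denominator e d c
    rewrite ℚP.normalize-coprime {suc d} {0} (Coprimality.sym (Coprimality.1-coprimeTo (suc d)))
          | ℚP.normalize-coprime {suc e} {0} (Coprimality.sym (Coprimality.1-coprimeTo (suc e))) =
    ℚP.toℚᵘ-injective (ℚᵘP.≃-trans
      (ℚP.toℚᵘ-homo-* (mkℚ +[1+ e ] d c) (mkℚ (+ suc d) 0 (Coprimality.sym (Coprimality.1-coprimeTo (suc d)))))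
      (*≡* cross))
    where
    cross : +[1+ e ] ℤ.* + suc d ℤ.* + 1 ≡ + suc e ℤ.* + suc (d ℕ.* 1)
    cross rewrite ℕP.*-identityʳ d = ℤP.*-identityʳ _

  -- For ε = u/w and s = 1/(δw) both ε = (uδ)s and the ratio (αw)s − (βw)s√3 are multiples of s.
  ratio-small : (m u w : ℕ) (ε : ℚ) → 1 ℕ.≤ u → 1 ℕ.≤ w → w ℕ.≤ 2 ℕ.^ (3 ℕ.+ m) → ε ℚ.* ℕ→ℚ w ≡ ℕ→ℚ u →
    AbsLt (ratio (3 ℕ.+ m)) ε
  ratio-small m u w ε u≥1 w≥1 w≤2ⁿ εw≡u =
    subst₂ AbsLt (sym ratio≡multiples) (sym ε≡multiple)
      (AbsLt-multiples s (1div-pos (δ ℕ.* w) (ℕP.*-mono-≤ δ≥1 w≥1)) (α ℕ.* w) (β ℕ.* w) (u ℕ.* δ)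
        (ℕP.*-mono-≤ β≥1 w≥1) (proj₁ gap) (proj₂ gap))
    where
    open AtLeastThree m
    α = ratioRe n
    β = ratioIm n
    δ = ratioDen m
    s = 1ℚ div ℕ→ℚ (δ ℕ.* w)
    δ≥1 : 1 ℕ.≤ δ
    δ≥1 = ℕP.*-mono-≤ (ℕP.≤-trans (s≤s z≤n) (ℕP.m≤n+m 8 (3 ℕ.* m ℕ.* m ℕ.+ 12 ℕ.* m)))
                      (ℕP.≤-trans (powRe≥1 n) (ℕP.m≤m+n (powRe n) (powIm n)))
    β≥1 : 1 ℕ.≤ β
    β≥1 = ℕP.*-mono-≤ (ℕP.m≤n+m 1 n)
            (ℕP.≤-trans (powRe≥1 n) (ℕP.≤-trans (ℕP.m≤n*m (powRe n) (2 ℕ.* n)) (ℕP.m≤m+n _ _)))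
    ratio≡multiples : ratio n ≡ (ℕ→ℚ (α ℕ.* w) ℚ.* s) + (ℚ.- (ℕ→ℚ (β ℕ.* w) ℚ.* s)) √3
    ratio≡multiples = ℚ√3-≡ (rescale (re (ratio n)) α δ w δ≥1 w≥1 re-ratio-scaled)
      (trans (neg-involutive (im (ratio n))) (cong ℚ.-_ (rescale (ℚ.- im (ratio n)) β δ w δ≥1 w≥1 im-ratio-scaled)))
      where
      neg-involutive : ∀ y → y ≡ ℚ.- (ℚ.- y)
      neg-involutive = solve-∀ ℚ-ring
    ε≡multiple : ε ≡ ℕ→ℚ (u ℕ.* δ) ℚ.* s
    ε≡multiple = trans (rescale ε u w δ w≥1 δ≥1 εw≡u)
                       (cong (λ k → ℕ→ℚ (u ℕ.* δ) ℚ.* (1ℚ div ℕ→ℚ k)) (ℕP.*-comm w δ))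
    gap = scaled-gap α β (u ℕ.* δ) w (ratioGap m) (proj₁ (ratio-norm-bounds m)) (proj₂ (ratio-norm-bounds m))
            (ratioGap-small m w u w≤2ⁿ u≥1) (ℕP.*-mono-≤ u≥1 δ≥1)

  expectedLucky∼asymp : (λ n → fromℚ (expectedLucky n)) ∼ asymp
  expectedLucky∼asymp (mkℚ +[1+ e ] d c) _ = 3 ℕ.+ suc d , λ n n≥ →
    subst (λ k → AbsLt (ratio k) (mkℚ +[1+ e ] d c)) (n≡3+[n∸3] n≥)
      (ratio-small (n ℕ.∸ 3) (suc e) (suc d) (mkℚ +[1+ e ] d c) (s≤s z≤n) (s≤s z≤n)
        (ℕP.<⇒≤ (ℕP.≤-<-trans (ℕP.≤-trans (ℕP.≤-trans (ℕP.m≤n+m (suc d) 3) n≥) (ℕP.≤-reflexive (sym (n≡3+[n∸3] n≥))))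
                               (n<2ⁿ (3 ℕ.+ (n ℕ.∸ 3)))))
        (*-denominator e d c))
    where
    n≡3+[n∸3] : ∀ {n} → 3 ℕ.+ suc d ℕ.≤ n → 3 ℕ.+ (n ℕ.∸ 3) ≡ n
    n≡3+[n∸3] n≥ = ℕP.m+[n∸m]≡n (ℕP.≤-trans (ℕP.m≤m+n 3 (suc d)) n≥)
  expectedLucky∼asymp (mkℚ (+ zero)   _ _) (*<* (ℤ.+<+ ()))
  expectedLucky∼asymp (mkℚ -[1+ _ ] _ _) (*<* ())

open ExactFormula using (expectedLucky≡numer⊘denom)
open Asymptotics using (expectedLucky∼asymp)

theorem3p9 : ((n : ℕ) → 1 ≤ n → fromℚ (expectedLucky n) ≡ numer n ⊘ denom n)
           × ((λ n → fromℚ (expectedLucky n)) ∼ asymp)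
-- the closed formula holds for n = 0 as well
theorem3p9 = (λ n _ → expectedLucky≡numer⊘denom n) , expectedLucky∼asymp
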